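{- Let $C\ge 1$ and write $C=\frac{k(k+1)}{2}+r$ with integers $k\ge 1$, $0\le r\le k$. Then for every $p\ge 2$, $$\gamma(C,p)=\begin{cases}\frac{p(p-1)}{2}, & \text{if } p\le 2k+1, \text{ or } p=2k+2 \text{ and } r\ge \frac{k+2}{2},\\[2pt] kp+2r-1, & \text{if } p=2k+2 \text{ and } 1\le r<\frac{k+2}{2},\\[2pt] kp+\left\lfloor\frac{rp}{k+1}\right\rfloor, & \text{otherwise}.\end{cases}$$ Moreover, in the first case the value is attained by a tournament on $p$ vertices, and in the other cases it is attained by a subdigraph of the circulant digraph on $\{0,\dots,p-1\}$ that contains all arcs $(i,i+\ell \bmod p)$ of lengths $\ell=1,\dots,k$, together with some arcs of length $k+1$ when $r>0$.
   Context: For $p\ge 2$ let $\vec C_p$ be the directed cycle on $\{0,\dots,p-1\}$ with arcs $(i,i+1\bmod p)$. Let $H$ be an oriented graph on $\{0,\dots,p-1\}$ (no loops and at most one arc between any two vertices). Each arc $(i,j)$ of $H$ is routed along the directed path from $i$ to $j$ in $\vec C_p$, of length $(j-i)\bmod p$; for an arc $e$ of $\vec C_p$, the load $L(H,e)$ is the number of arcs of $H$ whose route contains $e$. $\gamma(C,p)$ denotes the maximum number of arcs of such an $H$ satisfying $L(H,e)\le C$ for every arc $e$ of $\vec C_p$. -}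

module Defs where

open import Data.Nat using (ℕ; zero; suc; _+_; _*_; _∸_; _≤_; _<_; _≤ᵇ_; _<ᵇ_)
open import Data.Nat.DivMod using (_/_)
open import Data.Bool using (Bool; true; false; if_then_else_; _∧_)
open import Data.Fin using (Fin; toℕ)
open import Data.List using (List; map; allFin)
open import Data.Nat.ListAction using (sum)
open import Data.Product using (Σ; _×_; ∃)
open import Data.Sum using (_⊎_)
open import Relation.Binary.PropositionalEquality using (_≡_; _≢_)
open import Relation.Nullary using (¬_)

Digraph : ℕ → Set
Digraph p = Fin p → Fin p → Bool

Oriented : ∀ {p} → Digraph p → Set
Oriented {p} H = (∀ (i : Fin p) → H i i ≡ false)
               × (∀ (i j : Fin p) → H i j ≡ true → H j i ≡ false)

Tournament : ∀ {p} → Digraph p → Set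
Tournament {p} H = Oriented H × (∀ (i j : Fin p) → i ≢ j → (H i j ≡ true ⊎ H j i ≡ true))

-- length of the directed path from a to b in the directed cycle C_p,
-- i.e. (b - a) mod p, for a b < p.
dist : (p a b : ℕ) → ℕ
dist p a b = if a ≤ᵇ b then b ∸ a else (p ∸ a) + b

arcLen : ∀ {p} → Fin p → Fin p → ℕ
arcLen {p} i j = dist p (toℕ i) (toℕ j)

ind : Bool → ℕ
ind true  = 1
ind false = 0

sumFin : ∀ p → (Fin p → ℕ) → ℕ
sumFin p f = sum (map f (allFin p))

arcs : ∀ {p} → Digraph p → ℕ
arcs {p} H = sumFin p (λ i → sumFin p (λ j → ind (H i j)))

-- the arc e of C_p is the arc (e, e+1 mod p), identified with its tail e.
-- it lies on the route of (i,j) iff (e - i) mod p < (j - i) mod p.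
onRoute : ∀ {p} → Fin p → Fin p → Fin p → Bool
onRoute {p} i j e = dist p (toℕ i) (toℕ e) <ᵇ dist p (toℕ i) (toℕ j)

load : ∀ {p} → Digraph p → Fin p → ℕ
load {p} H e = sumFin p (λ i → sumFin p (λ j → ind (H i j ∧ onRoute i j e)))

Admissible : ∀ {p} → ℕ → Digraph p → Set
Admissible {p} C H = Oriented H × (∀ (e : Fin p) → load H e ≤ C)

GammaIs : ℕ → ℕ → ℕ → Set
GammaIs C p v = (Σ (Digraph p) λ H → Admissible C H × arcs H ≡ v)
              × (∀ (H : Digraph p) → Admissible C H → arcs H ≤ v)

CirculantSub : ∀ {p} → ℕ → ℕ → Digraph p → Set
CirculantSub {p} k r H =
    (∀ (i j : Fin p) → H i j ≡ true → arcLen i j ≤ suc k)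
  × (∀ (i j : Fin p) → 1 ≤ arcLen i j → arcLen i j ≤ k → H i j ≡ true)
  × (r ≡ 0 → ∀ (i j : Fin p) → H i j ≡ true → arcLen i j ≤ k)

Case1 : ℕ → ℕ → ℕ → Set
Case1 k r p = p ≤ 2 * k + 1 ⊎ (p ≡ 2 * k + 2 × k + 2 ≤ 2 * r)

Case2 : ℕ → ℕ → ℕ → Set
Case2 k r p = p ≡ 2 * k + 2 × 1 ≤ r × 2 * r < k + 2

-- Summing the loads of the p cycle arcs gives the total length of H, at most pC. Charging every
-- arc k + 1 instead of its length ℓ costs at most p · tri k extra, the shortfall of the arcs of
-- lengths ℓ ≤ k, so (k + 1)|H| ≤ pC + p · tri k = p(k(k + 1) + r); an oriented graph also has
-- 2|H| ≤ p(p − 1). For p = 2k + 2 and small r, |H| = kp + 2r would force every load to equal C,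
-- which fails on the cycle arc just before the tail of a diameter. The bounds are attained by
-- circulant digraphs: the arcs of lengths 1, …, k put load tri k on every cycle arc, and the arcs
-- of length k + 1 leave a set of tails meeting every k + 1 consecutive vertices at most r times,
-- a Sturmian set in general and an alternating choice of diameters when p = 2k + 2.

module Submission where

open import Defs
open import Data.Bool using (Bool; true; false; _∧_; _∨_; not; if_then_else_)
open import Data.Bool.Properties using (∧-comm; ∧-zeroʳ; ∨-zeroʳ)
open import Data.Empty using (⊥; ⊥-elim)
open import Data.Fin as Fin using (Fin; toℕ; fromℕ<)
open import Data.Fin.Properties using (toℕ<n; toℕ-injective; toℕ-fromℕ<)
import Data.List as List
open import Data.List.Properties using (map-tabulate)
open import Data.Nat
  using (ℕ; zero; suc; _+_; _*_; _∸_; _⊓_; _≤_; _<_; _≤ᵇ_; _<ᵇ_; _≡ᵇ_; _≤?_; _<?_; _≟_;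
         z≤n; s≤s; s≤s⁻¹; z<s; NonZero)
open import Data.Nat.DivMod using (_/_; m*n/n≡m; /-monoˡ-≤; +-distrib-/-∣ʳ; m/n*n≤m)
open import Data.Nat.Divisibility using (divides)
import Data.Nat.ListAction as ListAction
open import Data.Nat.Properties
open import Algebra.Properties.Semiring.Sum +-*-semiring
  using (sum; sum-syntax; sum-cong-≗; ∑-distrib-+; ∑-comm; *-distribˡ-sum; *-distribʳ-sum)
open import Data.Nat.Tactic.RingSolver using (solve-∀)
open import Data.Product using (Σ; ∃; _×_; _,_; proj₁; proj₂)
open import Data.Sum using (_⊎_; inj₁; inj₂)
open import Function using (_∘_)
open import Relation.Binary.Definitions using (tri<; tri≈; tri>)
open import Relation.Binary.PropositionalEquality
open import Relation.Nullary using (¬_; yes; no; contradiction)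
open import Relation.Nullary.Reflects using (Reflects; ofʸ; ofⁿ; det; invert; fromEquivalence)

module _ {P : Set} {b : Bool} (r : Reflects P b) where

  reflects-true : P → b ≡ true
  reflects-true p = det r (ofʸ p)

  reflects-false : ¬ P → b ≡ false
  reflects-false ¬p = det r (ofⁿ ¬p)

  reflects-sound : b ≡ true → P
  reflects-sound refl = invert r

≡ᵇ-reflects-≡ : ∀ m n → Reflects (m ≡ n) (m ≡ᵇ n)
≡ᵇ-reflects-≡ m n = fromEquivalence (≡ᵇ⇒≡ m n) (≡⇒≡ᵇ m n)

module _ {m n : ℕ} where

  <ᵇ-true : m < n → (m <ᵇ n) ≡ true
  <ᵇ-true = reflects-true (<ᵇ-reflects-< m n)

  <ᵇ-false : n ≤ m → (m <ᵇ n) ≡ false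
  <ᵇ-false n≤m = reflects-false (<ᵇ-reflects-< m n) (≤⇒≯ n≤m)

  <ᵇ-sound : (m <ᵇ n) ≡ true → m < n
  <ᵇ-sound = reflects-sound (<ᵇ-reflects-< m n)

  ≤ᵇ-true : m ≤ n → (m ≤ᵇ n) ≡ true
  ≤ᵇ-true = reflects-true (≤ᵇ-reflects-≤ m n)

  ≤ᵇ-false : n < m → (m ≤ᵇ n) ≡ false
  ≤ᵇ-false n<m = reflects-false (≤ᵇ-reflects-≤ m n) (<⇒≱ n<m)

  ≡ᵇ-true : m ≡ n → (m ≡ᵇ n) ≡ true
  ≡ᵇ-true = reflects-true (≡ᵇ-reflects-≡ m n)

  ≡ᵇ-false : m ≢ n → (m ≡ᵇ n) ≡ false
  ≡ᵇ-false = reflects-false (≡ᵇ-reflects-≡ m n)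

  ≡ᵇ-sound : (m ≡ᵇ n) ≡ true → m ≡ n
  ≡ᵇ-sound = reflects-sound (≡ᵇ-reflects-≡ m n)

∧-true : ∀ {x y} → (x ∧ y) ≡ true → x ≡ true × y ≡ true
∧-true {true} {true} _ = refl , refl

ind-∧ : ∀ x y → ind (x ∧ y) ≡ ind x * ind y
ind-∧ true  y = sym (+-identityʳ (ind y))
ind-∧ false y = refl

ind≤1 : ∀ x → ind x ≤ 1
ind≤1 true  = ≤-refl
ind≤1 false = z≤n

tri : ℕ → ℕ
tri zero    = 0
tri (suc n) = suc n + tri n

tri-mono-≤ : ∀ {a b} → a ≤ b → tri a ≤ tri b
tri-mono-≤ z≤n       = z≤n
tri-mono-≤ (s≤s a≤b) = +-mono-≤ (s≤s a≤b) (tri-mono-≤ a≤b)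

tri-double : ∀ k → tri k + tri k ≡ k * suc k
tri-double zero    = refl
tri-double (suc k) = begin
  suc k + tri k + (suc k + tri k)   ≡⟨ regroup (suc k) (tri k) ⟩
  2 * suc k + (tri k + tri k)       ≡⟨ cong (2 * suc k +_) (tri-double k) ⟩
  2 * suc k + k * suc k             ≡⟨ factor k ⟩
  suc k * suc (suc k)               ∎
  where
  open ≡-Reasoning
  regroup : ∀ a t → a + t + (a + t) ≡ 2 * a + (t + t)
  regroup = solve-∀
  factor : ∀ k → 2 * suc k + k * suc k ≡ suc k * suc (suc k)
  factor = solve-∀

tri≡k[k+1]/2 : ∀ k → (k * (k + 1)) / 2 ≡ tri k
tri≡k[k+1]/2 k = begin
  (k * (k + 1)) / 2  ≡⟨ cong (λ n → (k * n) / 2) (+-comm k 1) ⟩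
  (k * suc k) / 2    ≡⟨ cong (_/ 2) (trans (sym (tri-double k)) (cong (tri k +_) (sym (+-identityʳ (tri k))))) ⟩
  (2 * tri k) / 2    ≡⟨ cong (_/ 2) (*-comm 2 (tri k)) ⟩
  (tri k * 2) / 2    ≡⟨ m*n/n≡m (tri k) 2 ⟩
  tri k              ∎
  where open ≡-Reasoning

m+[n∸m]≡n+[m∸n] : ∀ m n → m + (n ∸ m) ≡ n + (m ∸ n)
m+[n∸m]≡n+[m∸n] zero    zero    = refl
m+[n∸m]≡n+[m∸n] zero    (suc n) = sym (+-identityʳ (suc n))
m+[n∸m]≡n+[m∸n] (suc m) zero    = +-identityʳ (suc m)
m+[n∸m]≡n+[m∸n] (suc m) (suc n) = cong suc (m+[n∸m]≡n+[m∸n] m n)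

m+n≤m⇒n≡0 : ∀ m n → m + n ≤ m → n ≡ 0
m+n≤m⇒n≡0 m n m+n≤m = n≤0⇒n≡0 (+-cancelˡ-≤ m n 0 (subst (m + n ≤_) (sym (+-identityʳ m)) m+n≤m))

2*m≤2*n+1⇒m≤n : ∀ {m n} → 2 * m ≤ 2 * n + 1 → m ≤ n
2*m≤2*n+1⇒m≤n {m} {n} 2m≤2n+1 = s≤s⁻¹ (*-cancelˡ-< 2 m (suc n) (s≤s (subst (2 * m ≤_) (twice+1 n) 2m≤2n+1)))
  where
  twice+1 : ∀ n → 2 * n + 1 ≡ n + suc (n + 0)
  twice+1 = solve-∀

[2*n]/2≡n : ∀ n → (2 * n) / 2 ≡ n
[2*n]/2≡n n = trans (cong (_/ 2) (*-comm 2 n)) (m*n/n≡m n 2)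

[n+a*m]/m≡n/m+a : ∀ n a m .{{_ : NonZero m}} → (n + a * m) / m ≡ n / m + a
[n+a*m]/m≡n/m+a n a m = trans (+-distrib-/-∣ʳ n (divides a refl)) (cong (n / m +_) (m*n/n≡m a m))

m*n≤m*a+b⇒n≤a+b/m : ∀ m a b n .{{_ : NonZero m}} → m * n ≤ m * a + b → n ≤ a + b / m
m*n≤m*a+b⇒n≤a+b/m m a b n m*n≤ = begin
  n                 ≡⟨ m*n/n≡m n m ⟨
  (n * m) / m       ≤⟨ /-monoˡ-≤ m (subst₂ _≤_ (*-comm m n) (trans (+-comm (m * a) b) (cong (b +_) (*-comm m a)))
                                           m*n≤) ⟩
  (b + a * m) / m   ≡⟨ [n+a*m]/m≡n/m+a b a m ⟩
  b / m + a         ≡⟨ +-comm (b / m) a ⟩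
  a + b / m         ∎
  where open ≤-Reasoning

a/m+b/m≤[a+b]/m : ∀ a b m .{{_ : NonZero m}} → a / m + b / m ≤ (a + b) / m
a/m+b/m≤[a+b]/m a b m = subst (_≤ (a + b) / m) (m*n/n≡m (a / m + b / m) m)
  (/-monoˡ-≤ m (subst (_≤ a + b) (sym (*-distribʳ-+ m (a / m) (b / m))) (+-mono-≤ (m/n*n≤m a m) (m/n*n≤m b m))))

even-or-odd : ∀ p → (∃ λ q → p ≡ q + q) ⊎ (∃ λ q → p ≡ suc (q + q))
even-or-odd zero = inj₁ (0 , refl)
even-or-odd (suc p) with even-or-odd p
... | inj₁ (q , p≡) = inj₂ (q , cong suc p≡)
... | inj₂ (q , p≡) = inj₁ (suc q , cong suc (trans p≡ (sym (+-suc q q))))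

Σℕ : ℕ → (ℕ → ℕ) → ℕ
Σℕ n f = ∑[ i < n ] f (toℕ i)

sumFin≡∑ : ∀ p (f : Fin p → ℕ) → sumFin p f ≡ ∑[ i < p ] f i
sumFin≡∑ p f = trans (cong ListAction.sum (map-tabulate (λ i → i) f)) (sum-tabulate p f)
  where
  sum-tabulate : ∀ n (g : Fin n → ℕ) → ListAction.sum (List.tabulate g) ≡ ∑[ i < n ] g i
  sum-tabulate zero    g = refl
  sum-tabulate (suc n) g = cong (g Fin.zero +_) (sum-tabulate n (g ∘ Fin.suc))

∑-const : ∀ n c → ∑[ i < n ] c ≡ n * c
∑-const zero    c = refl
∑-const (suc n) c = cong (c +_) (∑-const n c)

Σℕ-cong : ∀ n {f g : ℕ → ℕ} → (∀ i → i < n → f i ≡ g i) → Σℕ n f ≡ Σℕ n g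
Σℕ-cong n h = sum-cong-≗ {n} (λ i → h (toℕ i) (toℕ<n i))

Σℕ-+ : ∀ n (f g : ℕ → ℕ) → Σℕ n (λ i → f i + g i) ≡ Σℕ n f + Σℕ n g
Σℕ-+ n f g = ∑-distrib-+ {n} (f ∘ toℕ) (g ∘ toℕ)

Σℕ-zero : ∀ n {f : ℕ → ℕ} → (∀ i → i < n → f i ≡ 0) → Σℕ n f ≡ 0
Σℕ-zero n h = trans (Σℕ-cong n h) (trans (∑-const n 0) (*-zeroʳ n))

Σℕ-split : ∀ a b (f : ℕ → ℕ) → Σℕ (a + b) f ≡ Σℕ a f + Σℕ b (λ i → f (a + i))
Σℕ-split zero    b f = refl
Σℕ-split (suc a) b f = trans (cong (f 0 +_) (Σℕ-split a b (f ∘ suc))) (sym (+-assoc (f 0) _ _))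

Σℕ-snoc : ∀ n (f : ℕ → ℕ) → Σℕ (suc n) f ≡ Σℕ n f + f n
Σℕ-snoc zero    f = +-identityʳ (f 0)
Σℕ-snoc (suc n) f = trans (cong (f 0 +_) (Σℕ-snoc n (f ∘ suc))) (sym (+-assoc (f 0) _ _))

Σℕ-reverse : ∀ n (f : ℕ → ℕ) → Σℕ n (λ i → f (n ∸ suc i)) ≡ Σℕ n f
Σℕ-reverse zero    f = refl
Σℕ-reverse (suc n) f =
  trans (cong (f n +_) (Σℕ-reverse n f)) (trans (+-comm (f n) (Σℕ n f)) (sym (Σℕ-snoc n f)))

Σℕ-truncate : ∀ n s {f : ℕ → ℕ} → s ≤ n → (∀ i → s ≤ i → i < n → f i ≡ 0) → Σℕ n f ≡ Σℕ s f
Σℕ-truncate n s {f} s≤n h = begin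
  Σℕ n f                                   ≡⟨ cong (λ x → Σℕ x f) (m+[n∸m]≡n s≤n) ⟨
  Σℕ (s + (n ∸ s)) f                       ≡⟨ Σℕ-split s (n ∸ s) f ⟩
  Σℕ s f + Σℕ (n ∸ s) (λ i → f (s + i))    ≡⟨ cong (Σℕ s f +_) (Σℕ-zero (n ∸ s) tail-vanishes) ⟩
  Σℕ s f + 0                               ≡⟨ +-identityʳ _ ⟩
  Σℕ s f                                   ∎
  where
  open ≡-Reasoning
  tail-vanishes : ∀ i → i < n ∸ s → f (s + i) ≡ 0
  tail-vanishes i i<n∸s = h (s + i) (m≤m+n s i) (subst (s + i <_) (m+[n∸m]≡n s≤n) (+-monoʳ-< s i<n∸s))

Σℕ-cut : ∀ p y (f : ℕ → ℕ) → y ≤ p → Σℕ p (λ i → f i * ind (i <ᵇ y)) ≡ Σℕ y f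
Σℕ-cut p       zero    f _         = Σℕ-zero p (λ i _ → *-zeroʳ (f i))
Σℕ-cut (suc p) (suc y) f (s≤s y≤p) = cong₂ _+_ (*-identityʳ (f 0)) (Σℕ-cut p y (f ∘ suc) y≤p)

Σℕ-ind< : ∀ p L → L ≤ p → Σℕ p (λ ℓ → ind (ℓ <ᵇ L)) ≡ L
Σℕ-ind< p       zero    _         = Σℕ-zero p (λ _ _ → refl)
Σℕ-ind< (suc p) (suc L) (s≤s L≤p) = cong suc (Σℕ-ind< p L L≤p)

Σℕ-ind> : ∀ n x → Σℕ n (λ ℓ → ind (x <ᵇ ℓ)) ≡ n ∸ suc x
Σℕ-ind> zero    x       = refl
Σℕ-ind> (suc n) zero    = trans (∑-const n 1) (*-identityʳ n)
Σℕ-ind> (suc n) (suc x) = Σℕ-ind> n x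

Σℕ-point : ∀ p L (f : ℕ → ℕ) → L < p → Σℕ p (λ ℓ → ind (ℓ ≡ᵇ L) * f ℓ) ≡ f L
Σℕ-point (suc p) zero    f _         =
  trans (cong₂ _+_ (+-identityʳ (f 0)) (Σℕ-zero p (λ _ _ → refl))) (+-identityʳ (f 0))
Σℕ-point (suc p) (suc L) f (s≤s L<p) = Σℕ-point p L (f ∘ suc) L<p

Σℕ-tri : ∀ p s → s ≤ p → Σℕ p (s ∸_) ≡ tri s
Σℕ-tri p       zero    _         = Σℕ-zero p (λ i _ → 0∸n≡0 i)
Σℕ-tri (suc p) (suc s) (s≤s s≤p) = cong (suc s +_) (Σℕ-tri p s s≤p)

∑-mono-≤ : ∀ n {f g : Fin n → ℕ} → (∀ i → f i ≤ g i) → ∑[ i < n ] f i ≤ ∑[ i < n ] g i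
∑-mono-≤ zero    f≤g = z≤n
∑-mono-≤ (suc n) f≤g = +-mono-≤ (f≤g Fin.zero) (∑-mono-≤ n (f≤g ∘ Fin.suc))

∑-mono-< : ∀ n {f g : Fin n → ℕ} → (∀ i → f i ≤ g i) → ∀ i → f i < g i → ∑[ i < n ] f i < ∑[ i < n ] g i
∑-mono-< (suc n) f≤g Fin.zero    f<g = +-mono-<-≤ f<g (∑-mono-≤ n (f≤g ∘ Fin.suc))
∑-mono-< (suc n) f≤g (Fin.suc i) f<g = +-mono-≤-< (f≤g Fin.zero) (∑-mono-< n (f≤g ∘ Fin.suc) i f<g)

∑≡0⇒≡0 : ∀ n (f : Fin n → ℕ) → ∑[ i < n ] f i ≡ 0 → ∀ i → f i ≡ 0
∑≡0⇒≡0 (suc n) f ∑≡0 Fin.zero    = m+n≡0⇒m≡0 (f Fin.zero) ∑≡0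
∑≡0⇒≡0 (suc n) f ∑≡0 (Fin.suc i) = ∑≡0⇒≡0 n (f ∘ Fin.suc) (m+n≡0⇒n≡0 (f Fin.zero) ∑≡0) i

∑>0⇒∃>0 : ∀ n (f : Fin n → ℕ) → 0 < ∑[ i < n ] f i → ∃ λ i → 0 < f i
∑>0⇒∃>0 (suc n) f ∑>0 with f Fin.zero in f₀
... | suc _ = Fin.zero , subst (0 <_) (sym f₀) z<s
... | zero with ∑>0⇒∃>0 n (f ∘ Fin.suc) ∑>0
...   | i , fi>0 = Fin.suc i , fi>0

∑² : ∀ p → (Fin p → Fin p → ℕ) → ℕ
∑² p F = ∑[ i < p ] ∑[ j < p ] F i j

∑²-cong : ∀ p {F G : Fin p → Fin p → ℕ} → (∀ i j → F i j ≡ G i j) → ∑² p F ≡ ∑² p G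
∑²-cong p F≡G = sum-cong-≗ {p} (λ i → sum-cong-≗ {p} (F≡G i))

∑²-mono-≤ : ∀ p {F G : Fin p → Fin p → ℕ} → (∀ i j → F i j ≤ G i j) → ∑² p F ≤ ∑² p G
∑²-mono-≤ p F≤G = ∑-mono-≤ p (λ i → ∑-mono-≤ p (F≤G i))

∑²-mono-< : ∀ p {F G : Fin p → Fin p → ℕ} → (∀ i j → F i j ≤ G i j) →
            ∀ i j → F i j < G i j → ∑² p F < ∑² p G
∑²-mono-< p F≤G i j F<G = ∑-mono-< p (λ i → ∑-mono-≤ p (F≤G i)) i (∑-mono-< p (F≤G i) j F<G)

∑²-+ : ∀ p (F G : Fin p → Fin p → ℕ) → ∑² p (λ i j → F i j + G i j) ≡ ∑² p F + ∑² p G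
∑²-+ p F G = trans (sum-cong-≗ {p} (λ i → ∑-distrib-+ {p} (F i) (G i))) (∑-distrib-+ {p} _ _)

∑²-*ʳ : ∀ p (F : Fin p → Fin p → ℕ) c → ∑² p (λ i j → F i j * c) ≡ ∑² p F * c
∑²-*ʳ p F c = sym (trans (*-distribʳ-sum {p} c _) (sum-cong-≗ {p} (λ i → *-distribʳ-sum {p} c (F i))))

∑²-zero : ∀ p (F : Fin p → Fin p → ℕ) → ∑² p F ≡ 0 → ∀ i j → F i j ≡ 0
∑²-zero p F ∑≡0 i = ∑≡0⇒≡0 p (F i) (∑≡0⇒≡0 p _ ∑≡0 i)

∑²-positive : ∀ p (F : Fin p → Fin p → ℕ) → 0 < ∑² p F → ∃ λ i → ∃ λ j → 0 < F i j
∑²-positive p F ∑>0 with ∑>0⇒∃>0 p _ ∑>0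
... | i , ∑ᵢ>0 with ∑>0⇒∃>0 p (F i) ∑ᵢ>0
...   | j , Fij>0 = i , j , Fij>0

double-sumFin : ∀ p (F : Fin p → Fin p → ℕ) → sumFin p (λ i → sumFin p (F i)) ≡ ∑² p F
double-sumFin p F = trans (sumFin≡∑ p _) (sum-cong-≗ {p} (λ i → sumFin≡∑ p (F i)))

arcs≡∑² : ∀ {p} (H : Digraph p) → arcs H ≡ ∑² p (λ i j → ind (H i j))
arcs≡∑² {p} H = double-sumFin p (λ i j → ind (H i j))

load≡∑² : ∀ {p} (H : Digraph p) e → load H e ≡ ∑² p (λ i j → ind (H i j ∧ onRoute i j e))
load≡∑² {p} H e = double-sumFin p (λ i j → ind (H i j ∧ onRoute i j e))

-- Distances along the directed cycle

module _ (p : ℕ) {a b : ℕ} where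

  dist-≤ : a ≤ b → dist p a b ≡ b ∸ a
  dist-≤ a≤b rewrite ≤ᵇ-true a≤b = refl

  dist-> : b < a → dist p a b ≡ (p ∸ a) + b
  dist-> b<a rewrite ≤ᵇ-false b<a = refl

dist-self : ∀ p a → dist p a a ≡ 0
dist-self p a = trans (dist-≤ p {a} {a} ≤-refl) (n∸n≡0 a)

dist<p : ∀ p {a b} → a < p → b < p → dist p a b < p
dist<p p {a} {b} a<p b<p with a ≤? b
... | yes a≤b = subst (_< p) (sym (dist-≤ p a≤b)) (≤-<-trans (m∸n≤m b a) b<p)
... | no a≰b  = subst (_< p) (sym (dist-> p (≰⇒> a≰b)))
  (subst ((p ∸ a) + b <_) (m∸n+n≡m (<⇒≤ a<p)) (+-monoʳ-< (p ∸ a) (≰⇒> a≰b)))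

dist-complement : ∀ p {a b} → a < p → b < p → a ≢ b → dist p a b + dist p b a ≡ p
dist-complement p {a} {b} a<p b<p a≢b with <-cmp a b
... | tri≈ _ a≡b _ = contradiction a≡b a≢b
... | tri< a<b _ _ rewrite dist-≤ p (<⇒≤ a<b) | dist-> p a<b = begin
  (b ∸ a) + ((p ∸ b) + a)  ≡⟨ shuffle (b ∸ a) (p ∸ b) a ⟩
  ((p ∸ b) + (b ∸ a)) + a  ≡⟨ cong (_+ a) (trans (sym (+-∸-assoc (p ∸ b) (<⇒≤ a<b)))
                                                 (cong (_∸ a) (m∸n+n≡m (<⇒≤ b<p)))) ⟩
  (p ∸ a) + a              ≡⟨ m∸n+n≡m (<⇒≤ a<p) ⟩
  p                        ∎
  where
  open ≡-Reasoning
  shuffle : ∀ x y z → x + (y + z) ≡ (y + x) + z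
  shuffle = solve-∀
... | tri> _ _ b<a rewrite dist-> p b<a | dist-≤ p (<⇒≤ b<a) =
  trans (+-assoc (p ∸ a) b (a ∸ b)) (trans (cong ((p ∸ a) +_) (m+[n∸m]≡n (<⇒≤ b<a))) (m∸n+n≡m (<⇒≤ a<p)))

dist-wrapped-longer : ∀ p {a b c} → a ≤ b → b < p → c < a → dist p a b < dist p a c
dist-wrapped-longer p {a} {b} {c} a≤b b<p c<a = subst₂ _<_ (sym (dist-≤ p a≤b)) (sym (dist-> p c<a))
  (≤-trans (∸-monoˡ-< b<p a≤b) (m≤m+n (p ∸ a) c))

dist-injectiveʳ : ∀ p {a b c} → b < p → c < p → dist p a b ≡ dist p a c → b ≡ c
dist-injectiveʳ p {a} {b} {c} b<p c<p e with a ≤? b | a ≤? c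
... | yes a≤b | yes a≤c = ∸-cancelʳ-≡ a≤b a≤c (trans (sym (dist-≤ p a≤b)) (trans e (dist-≤ p a≤c)))
... | no a≰b  | no a≰c  =
  +-cancelˡ-≡ (p ∸ a) b c (trans (sym (dist-> p (≰⇒> a≰b))) (trans e (dist-> p (≰⇒> a≰c))))
... | yes a≤b | no a≰c  = contradiction e (<⇒≢ (dist-wrapped-longer p a≤b b<p (≰⇒> a≰c)))
... | no a≰b  | yes a≤c = contradiction (sym e) (<⇒≢ (dist-wrapped-longer p a≤c c<p (≰⇒> a≰b)))

dist≡0⇒≡ : ∀ p {a b} → a < p → dist p a b ≡ 0 → a ≡ b
dist≡0⇒≡ p {a} {b} a<p e with a ≤? b
... | yes a≤b = ≤-antisym a≤b (m∸n≡0⇒m≤n (trans (sym (dist-≤ p a≤b)) e))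
... | no a≰b  = contradiction (trans (sym (dist-> p (≰⇒> a≰b))) e)
  (≢-sym (<⇒≢ (≤-trans (m<n⇒0<n∸m a<p) (m≤m+n (p ∸ a) b))))

arcLen≡0⇒≡ : ∀ {p} (i j : Fin p) → arcLen i j ≡ 0 → i ≡ j
arcLen≡0⇒≡ {p} i j e = toℕ-injective (dist≡0⇒≡ p (toℕ<n i) e)

cyclePred : ℕ → ℕ → ℕ
cyclePred p zero    = p ∸ 1
cyclePred p (suc a) = a

cyclePred<p : ∀ {p a} → a < p → cyclePred p a < p
cyclePred<p {suc p} {zero}  _   = n<1+n p
cyclePred<p {p}     {suc a} a<p = <-trans (n<1+n a) a<p

dist-cyclePred-self : ∀ p a → a < p → dist p a (cyclePred p a) ≡ p ∸ 1
dist-cyclePred-self p       zero    _   = dist-≤ p z≤n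
dist-cyclePred-self (suc p) (suc a) a<p = trans (dist-> (suc p) (n<1+n a)) (m∸n+n≡m (<⇒≤ (s≤s⁻¹ a<p)))

dist-cyclePred : ∀ p i a → i < p → a < p → i ≢ a → suc (dist p i (cyclePred p a)) ≡ dist p i a
dist-cyclePred p zero    zero    _   _ i≢a = contradiction refl i≢a
dist-cyclePred p (suc i) zero    i<p _ _   = begin
  suc (dist p (suc i) (p ∸ 1))  ≡⟨ cong suc (dist-≤ p i<p′) ⟩
  suc (p ∸ 1 ∸ suc i)           ≡⟨ +-∸-assoc 1 i<p′ ⟨
  suc (p ∸ 1) ∸ suc i           ≡⟨ cong (_∸ suc i) (trans (+-comm 1 (p ∸ 1)) (m∸n+n≡m (≤-trans (s≤s z≤n) i<p))) ⟩
  p ∸ suc i                     ≡⟨ +-identityʳ (p ∸ suc i) ⟨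
  p ∸ suc i + 0                 ≡⟨ dist-> p (s≤s z≤n) ⟨
  dist p (suc i) 0              ∎
  where
  open ≡-Reasoning
  i<p′ : suc i ≤ p ∸ 1
  i<p′ = ∸-monoˡ-≤ 1 i<p
dist-cyclePred p i (suc a) i<p a<p i≢a with i ≤? a
... | yes i≤a = trans (cong suc (dist-≤ p i≤a))
                      (trans (sym (+-∸-assoc 1 i≤a)) (sym (dist-≤ p (m≤n⇒m≤1+n i≤a))))
... | no i≰a  = trans (cong suc (dist-> p (≰⇒> i≰a))) (trans (sym (+-suc (p ∸ i) a)) (sym (dist-> p a+1<i)))
  where
  a+1<i : suc a < i
  a+1<i = ≤∧≢⇒< (≰⇒> i≰a) (≢-sym i≢a)

Σℕ-dist-from : ∀ p a (g : ℕ → ℕ) → a < p → Σℕ p (λ b → g (dist p a b)) ≡ Σℕ p g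
Σℕ-dist-from p a g a<p = begin
  Σℕ p (λ b → g (dist p a b))
    ≡⟨ cong (λ x → Σℕ x (λ b → g (dist p a b))) (m+[n∸m]≡n a≤p) ⟨
  Σℕ (a + (p ∸ a)) (λ b → g (dist p a b))
    ≡⟨ Σℕ-split a (p ∸ a) (λ b → g (dist p a b)) ⟩
  Σℕ a (λ b → g (dist p a b)) + Σℕ (p ∸ a) (λ i → g (dist p a (a + i)))
    ≡⟨ cong₂ _+_ (Σℕ-cong a (λ b b<a → cong g (dist-> p b<a)))
                 (Σℕ-cong (p ∸ a) (λ i _ → cong g (trans (dist-≤ p (m≤m+n a i)) (m+n∸m≡n a i)))) ⟩
  Σℕ a (λ b → g ((p ∸ a) + b)) + Σℕ (p ∸ a) g
    ≡⟨ +-comm _ (Σℕ (p ∸ a) g) ⟩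
  Σℕ (p ∸ a) g + Σℕ a (λ b → g ((p ∸ a) + b))
    ≡⟨ Σℕ-split (p ∸ a) a g ⟨
  Σℕ ((p ∸ a) + a) g
    ≡⟨ cong (λ x → Σℕ x g) (m∸n+n≡m a≤p) ⟩
  Σℕ p g ∎
  where
  open ≡-Reasoning
  a≤p : a ≤ p
  a≤p = <⇒≤ a<p

Σℕ-dist-to : ∀ p e (g : ℕ → ℕ) → e < p → Σℕ p (λ a → g (dist p a e)) ≡ Σℕ p g
Σℕ-dist-to p e g e<p = begin
  Σℕ p G
    ≡⟨ cong (λ x → Σℕ x G) p≡ ⟨
  Σℕ (suc e + q) G
    ≡⟨ Σℕ-split (suc e) q G ⟩
  Σℕ (suc e) G + Σℕ q (λ i → G (suc e + i))
    ≡⟨ cong₂ _+_ (Σℕ-cong (suc e) (λ a a≤e → cong g (dist-≤ p (s≤s⁻¹ a≤e))))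
                 (Σℕ-cong q (λ i i<q → cong g (wrapped i i<q))) ⟩
  Σℕ (suc e) (λ i → g (suc e ∸ suc i)) + Σℕ q (λ i → g (suc e + (q ∸ suc i)))
    ≡⟨ cong₂ _+_ (Σℕ-reverse (suc e) g) (Σℕ-reverse q (λ j → g (suc e + j))) ⟩
  Σℕ (suc e) g + Σℕ q (λ j → g (suc e + j))
    ≡⟨ Σℕ-split (suc e) q g ⟨
  Σℕ (suc e + q) g
    ≡⟨ cong (λ x → Σℕ x g) p≡ ⟩
  Σℕ p g ∎
  where
  open ≡-Reasoning
  G : ℕ → ℕ
  G a = g (dist p a e)
  q : ℕ
  q = p ∸ suc e
  p≡ : suc e + q ≡ p
  p≡ = m+[n∸m]≡n e<p
  wrapped : ∀ i → i < q → dist p (suc e + i) e ≡ suc e + (q ∸ suc i)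
  wrapped i i<q = begin
    dist p (suc e + i) e     ≡⟨ dist-> p (s≤s (m≤m+n e i)) ⟩
    p ∸ (suc e + i) + e      ≡⟨ cong (λ x → x ∸ (suc e + i) + e) p≡ ⟨
    suc e + q ∸ (suc e + i) + e ≡⟨ cong (_+ e) ([m+n]∸[m+o]≡n∸o (suc e) q i) ⟩
    q ∸ i + e                ≡⟨ cong (_+ e) (+-∸-assoc 1 i<q) ⟩
    suc (q ∸ suc i) + e      ≡⟨ +-comm (suc (q ∸ suc i)) e ⟩
    e + suc (q ∸ suc i)      ≡⟨ +-suc e (q ∸ suc i) ⟩
    suc e + (q ∸ suc i)      ∎

-- Circulant digraphs

isShort : ℕ → ℕ → Bool
isShort s ℓ = (0 <ᵇ ℓ) ∧ (ℓ <ᵇ suc s)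

isShort-sound : ∀ s ℓ → isShort s ℓ ≡ true → 1 ≤ ℓ × ℓ ≤ s
isShort-sound s ℓ e with ∧-true {0 <ᵇ ℓ} e
... | e₁ , e₂ = <ᵇ-sound e₁ , s≤s⁻¹ (<ᵇ-sound e₂)

isShort-complete : ∀ {s ℓ} → 1 ≤ ℓ → ℓ ≤ s → isShort s ℓ ≡ true
isShort-complete 1≤ℓ ℓ≤s rewrite <ᵇ-true 1≤ℓ | <ᵇ-true (s≤s ℓ≤s) = refl

isShort∧<ᵇ : ∀ s y ℓ → ind (isShort s ℓ) * ind (y <ᵇ ℓ) ≡ ind ((y <ᵇ ℓ) ∧ (ℓ <ᵇ suc s))
isShort∧<ᵇ s y zero    = refl
isShort∧<ᵇ s y (suc ℓ) = trans (sym (ind-∧ (ℓ <ᵇ s) (y <ᵇ suc ℓ))) (cong ind (∧-comm (ℓ <ᵇ s) _))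

isShort-false : ∀ {s ℓ} → s < ℓ → isShort s ℓ ≡ false
isShort-false {s} {ℓ} s<ℓ rewrite <ᵇ-false {ℓ} {suc s} s<ℓ = ∧-zeroʳ (0 <ᵇ ℓ)

Σℕ-between : ∀ p t x → t ≤ p → Σℕ p (λ ℓ → ind ((x <ᵇ ℓ) ∧ (ℓ <ᵇ t))) ≡ t ∸ suc x
Σℕ-between p       zero    x       _         = Σℕ-zero p (λ ℓ _ → cong ind (∧-zeroʳ (x <ᵇ ℓ)))
Σℕ-between (suc p) (suc t) zero    (s≤s t≤p) = Σℕ-ind< p t t≤p
Σℕ-between (suc p) (suc t) (suc x) (s≤s t≤p) = Σℕ-between p t x t≤p

ind-∨-disjoint : ∀ S E C → (S ≡ true → E ≡ false) → ind (S ∨ (E ∧ C)) ≡ ind S + ind E * ind C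
ind-∨-disjoint true  E C h rewrite h refl = refl
ind-∨-disjoint false E C _ = ind-∧ E C

circulantArc : ℕ → ℕ → (ℕ → Bool) → ℕ → ℕ → Bool
circulantArc p s chosen a b = isShort s (dist p a b) ∨ ((dist p a b ≡ᵇ suc s) ∧ chosen a)

circulant : ∀ p → ℕ → (ℕ → Bool) → Digraph p
circulant p s chosen i j = circulantArc p s chosen (toℕ i) (toℕ j)

short-load : ∀ p s x → s < p → x < p →
  Σℕ p (λ a → Σℕ p (λ b → ind (isShort s (dist p a b)) * ind (dist p a x <ᵇ dist p a b))) ≡ tri s
short-load p s x s<p x<p = begin
  Σℕ p (λ a → Σℕ p (λ b → ind (isShort s (dist p a b)) * ind (dist p a x <ᵇ dist p a b)))
    ≡⟨ Σℕ-cong p (λ a a<p → from a a<p) ⟩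
  Σℕ p (λ a → s ∸ dist p a x)
    ≡⟨ Σℕ-dist-to p x (s ∸_) x<p ⟩
  Σℕ p (s ∸_)
    ≡⟨ Σℕ-tri p s (<⇒≤ s<p) ⟩
  tri s ∎
  where
  open ≡-Reasoning
  from : ∀ a → a < p → Σℕ p (λ b → ind (isShort s (dist p a b)) * ind (dist p a x <ᵇ dist p a b)) ≡ s ∸ dist p a x
  from a a<p = begin
    Σℕ p (λ b → ind (isShort s (dist p a b)) * ind (y <ᵇ dist p a b))
      ≡⟨ Σℕ-dist-from p a (λ ℓ → ind (isShort s ℓ) * ind (y <ᵇ ℓ)) a<p ⟩
    Σℕ p (λ ℓ → ind (isShort s ℓ) * ind (y <ᵇ ℓ))
      ≡⟨ Σℕ-cong p (λ ℓ _ → isShort∧<ᵇ s y ℓ) ⟩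
    Σℕ p (λ ℓ → ind ((y <ᵇ ℓ) ∧ (ℓ <ᵇ suc s)))
      ≡⟨ Σℕ-between p (suc s) y s<p ⟩
    s ∸ y ∎
    where
    y : ℕ
    y = dist p a x

module Circulant (p s : ℕ) (chosen : ℕ → Bool) (s+1<p : suc s < p) where

  H : Digraph p
  H = circulant p s chosen

  longLoad : ℕ → ℕ
  longLoad x = Σℕ p (λ a → ind (chosen a) * ind (dist p a x <ᵇ suc s))

  arc-indicator : ∀ a ℓ → ind (isShort s ℓ ∨ ((ℓ ≡ᵇ suc s) ∧ chosen a))
                        ≡ ind (isShort s ℓ) + ind (ℓ ≡ᵇ suc s) * ind (chosen a)
  arc-indicator a ℓ = ind-∨-disjoint (isShort s ℓ) (ℓ ≡ᵇ suc s) (chosen a) short-not-long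
    where
    short-not-long : isShort s ℓ ≡ true → (ℓ ≡ᵇ suc s) ≡ false
    short-not-long e = ≡ᵇ-false (<⇒≢ (s≤s (proj₂ (isShort-sound s ℓ e))))

  out-degree : ∀ a → a < p → Σℕ p (λ b → ind (circulantArc p s chosen a b)) ≡ s + ind (chosen a)
  out-degree a a<p = begin
    Σℕ p (λ b → ind (circulantArc p s chosen a b))
      ≡⟨ Σℕ-dist-from p a (λ ℓ → ind (isShort s ℓ ∨ ((ℓ ≡ᵇ suc s) ∧ chosen a))) a<p ⟩
    Σℕ p (λ ℓ → ind (isShort s ℓ ∨ ((ℓ ≡ᵇ suc s) ∧ chosen a)))
      ≡⟨ Σℕ-cong p (λ ℓ _ → arc-indicator a ℓ) ⟩
    Σℕ p (λ ℓ → ind (isShort s ℓ) + ind (ℓ ≡ᵇ suc s) * ind (chosen a))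
      ≡⟨ Σℕ-+ p (ind ∘ isShort s) (λ ℓ → ind (ℓ ≡ᵇ suc s) * ind (chosen a)) ⟩
    Σℕ p (λ ℓ → ind (isShort s ℓ)) + Σℕ p (λ ℓ → ind (ℓ ≡ᵇ suc s) * ind (chosen a))
      ≡⟨ cong₂ _+_ (Σℕ-between p (suc s) 0 (<⇒≤ s+1<p)) (Σℕ-point p (suc s) (λ _ → ind (chosen a)) s+1<p) ⟩
    s + ind (chosen a) ∎
    where open ≡-Reasoning

  arc-on-route : ∀ a b Y →
    ind (circulantArc p s chosen a b ∧ Y)
    ≡ ind (isShort s (dist p a b)) * ind Y + ind (dist p a b ≡ᵇ suc s) * (ind (chosen a) * ind Y)
  arc-on-route a b Y = begin
    ind (circulantArc p s chosen a b ∧ Y)                     ≡⟨ ind-∧ _ Y ⟩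
    ind (circulantArc p s chosen a b) * ind Y                 ≡⟨ cong (_* ind Y) (arc-indicator a ℓ) ⟩
    (ind (isShort s ℓ) + ind (ℓ ≡ᵇ suc s) * ind (chosen a)) * ind Y
      ≡⟨ *-distribʳ-+ (ind Y) (ind (isShort s ℓ)) _ ⟩
    ind (isShort s ℓ) * ind Y + ind (ℓ ≡ᵇ suc s) * ind (chosen a) * ind Y
      ≡⟨ cong (ind (isShort s ℓ) * ind Y +_) (*-assoc (ind (ℓ ≡ᵇ suc s)) _ _) ⟩
    ind (isShort s ℓ) * ind Y + ind (ℓ ≡ᵇ suc s) * (ind (chosen a) * ind Y) ∎
    where
    open ≡-Reasoning
    ℓ : ℕ
    ℓ = dist p a b

  long-load-from : ∀ a x → a < p →
    Σℕ p (λ b → ind (dist p a b ≡ᵇ suc s) * (ind (chosen a) * ind (dist p a x <ᵇ dist p a b)))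
    ≡ ind (chosen a) * ind (dist p a x <ᵇ suc s)
  long-load-from a x a<p =
    trans (Σℕ-dist-from p a (λ ℓ → ind (ℓ ≡ᵇ suc s) * (ind (chosen a) * ind (y <ᵇ ℓ))) a<p)
          (Σℕ-point p (suc s) (λ ℓ → ind (chosen a) * ind (y <ᵇ ℓ)) s+1<p)
    where
    y : ℕ
    y = dist p a x

  load-circulant : ∀ e → load H e ≡ tri s + longLoad (toℕ e)
  load-circulant e = begin
    load H e
      ≡⟨ load≡∑² H e ⟩
    ∑² p (λ i j → ind (H i j ∧ onRoute i j e))
      ≡⟨ ∑²-cong p (λ i j → arc-on-route (toℕ i) (toℕ j) (onRoute i j e)) ⟩
    ∑² p (λ i j → short i j + long i j)
      ≡⟨ ∑²-+ p short long ⟩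
    ∑² p short + ∑² p long
      ≡⟨ cong₂ _+_ (short-load p s x s<p (toℕ<n e)) (Σℕ-cong p (λ a a<p → long-load-from a x a<p)) ⟩
    tri s + longLoad x ∎
    where
    open ≡-Reasoning
    x : ℕ
    x = toℕ e
    s<p : s < p
    s<p = <-trans (n<1+n s) s+1<p
    short long : Fin p → Fin p → ℕ
    short i j = ind (isShort s (arcLen i j)) * ind (onRoute i j e)
    long i j = ind (arcLen i j ≡ᵇ suc s) * (ind (chosen (toℕ i)) * ind (onRoute i j e))

  arcs-circulant : arcs H ≡ p * s + Σℕ p (ind ∘ chosen)
  arcs-circulant = begin
    arcs H                                              ≡⟨ double-sumFin p (λ i j → ind (H i j)) ⟩
    Σℕ p (λ a → Σℕ p (λ b → ind (circulantArc p s chosen a b))) ≡⟨ Σℕ-cong p out-degree ⟩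
    Σℕ p (λ a → s + ind (chosen a))                     ≡⟨ Σℕ-+ p (λ _ → s) (ind ∘ chosen) ⟩
    Σℕ p (λ _ → s) + Σℕ p (ind ∘ chosen)                ≡⟨ cong (_+ Σℕ p (ind ∘ chosen)) (∑-const p s) ⟩
    p * s + Σℕ p (ind ∘ chosen)                         ∎
    where open ≡-Reasoning

  arc-cases : ∀ a b → circulantArc p s chosen a b ≡ true →
              (1 ≤ dist p a b × dist p a b ≤ s) ⊎ (dist p a b ≡ suc s × chosen a ≡ true)
  arc-cases a b e with isShort s (dist p a b) in short
  ... | true  = inj₁ (isShort-sound s (dist p a b) short)
  ... | false with ∧-true {dist p a b ≡ᵇ suc s} e
  ...   | long , c = inj₂ (≡ᵇ-sound long , c)

  arc-positive : ∀ a b → circulantArc p s chosen a b ≡ true → 1 ≤ dist p a b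
  arc-positive a b e with arc-cases a b e
  ... | inj₁ (1≤d , _) = 1≤d
  ... | inj₂ (d≡ , _)  = subst (1 ≤_) (sym d≡) (s≤s z≤n)

  short-arc : ∀ a b → 1 ≤ dist p a b → dist p a b ≤ s → circulantArc p s chosen a b ≡ true
  short-arc a b 1≤d d≤s rewrite isShort-complete {s} 1≤d d≤s = refl

  long-arc : ∀ a b → dist p a b ≡ suc s → chosen a ≡ true → circulantArc p s chosen a b ≡ true
  long-arc a b d≡ c rewrite ≡ᵇ-true d≡ | c = ∨-zeroʳ (isShort s (dist p a b))

  loop-free : ∀ i → H i i ≡ false
  loop-free i rewrite dist-self p (toℕ i) = refl

  circulant-oriented :
    s + s < p →
    (∀ a → chosen a ≡ true → s + suc s < p) →
    (∀ a b → a < p → b < p → dist p a b ≡ suc s → dist p b a ≡ suc s → chosen a ≡ true → chosen b ≡ true → ⊥) →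
    Oriented H
  circulant-oriented short-short short-long long-long = loop-free , antisymmetric
    where
    antisymmetric : ∀ i j → H i j ≡ true → H j i ≡ false
    antisymmetric i j ij with H j i in ji
    ... | false = refl
    ... | true  = ⊥-elim (both (arc-cases a b ij) (arc-cases b a ji))
      where
      a : ℕ
      a = toℕ i
      b : ℕ
      b = toℕ j
      a≢b : a ≢ b
      a≢b a≡b = <⇒≢ (arc-positive a b ij) (sym (trans (cong (dist p a) (sym a≡b)) (dist-self p a)))
      round : dist p a b + dist p b a ≡ p
      round = dist-complement p (toℕ<n i) (toℕ<n j) a≢b
      both : _ → _ → ⊥
      both (inj₁ (_ , ab≤s)) (inj₁ (_ , ba≤s)) =
        <⇒≱ short-short (subst (_≤ s + s) round (+-mono-≤ ab≤s ba≤s))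
      both (inj₁ (_ , ab≤s)) (inj₂ (ba≡ , cb)) =
        <⇒≱ (short-long b cb) (subst (_≤ s + suc s) round (+-mono-≤ ab≤s (≤-reflexive ba≡)))
      both (inj₂ (ab≡ , ca)) (inj₁ (_ , ba≤s)) =
        <⇒≱ (short-long a ca) (subst (_≤ s + suc s) (trans (+-comm (dist p b a) (dist p a b)) round)
                                     (+-mono-≤ ba≤s (≤-reflexive ab≡)))
      both (inj₂ (ab≡ , ca)) (inj₂ (ba≡ , cb)) = long-long a b (toℕ<n i) (toℕ<n j) ab≡ ba≡ ca cb

  circulant-tournament :
    Oriented H →
    (∀ a b → a < p → b < p → a ≢ b →
       (dist p a b ≤ s ⊎ dist p b a ≤ s) ⊎
       ((dist p a b ≡ suc s × chosen a ≡ true) ⊎ (dist p b a ≡ suc s × chosen b ≡ true))) →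
    Tournament H
  circulant-tournament oriented covered = oriented , complete
    where
    positive : ∀ i j → i ≢ j → 1 ≤ dist p (toℕ i) (toℕ j)
    positive i j i≢j = n≢0⇒n>0 (λ d≡0 → i≢j (arcLen≡0⇒≡ i j d≡0))
    complete : ∀ i j → i ≢ j → H i j ≡ true ⊎ H j i ≡ true
    complete i j i≢j with covered (toℕ i) (toℕ j) (toℕ<n i) (toℕ<n j) (i≢j ∘ toℕ-injective)
    ... | inj₁ (inj₁ ij≤s)        = inj₁ (short-arc (toℕ i) (toℕ j) (positive i j i≢j) ij≤s)
    ... | inj₁ (inj₂ ji≤s)        = inj₂ (short-arc (toℕ j) (toℕ i) (positive j i (i≢j ∘ sym)) ji≤s)
    ... | inj₂ (inj₁ (ij≡ , ci)) = inj₁ (long-arc (toℕ i) (toℕ j) ij≡ ci)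
    ... | inj₂ (inj₂ (ji≡ , cj)) = inj₂ (long-arc (toℕ j) (toℕ i) ji≡ cj)

  circulant-sub : ∀ r → (r ≡ 0 → ∀ a → chosen a ≡ false) → CirculantSub s r H
  circulant-sub r none-chosen = at-most-long , short-arc-fin , only-short
    where
    at-most-long : ∀ i j → H i j ≡ true → arcLen i j ≤ suc s
    at-most-long i j e with arc-cases (toℕ i) (toℕ j) e
    ... | inj₁ (_ , d≤s) = m≤n⇒m≤1+n d≤s
    ... | inj₂ (d≡ , _)  = ≤-reflexive d≡
    short-arc-fin : ∀ i j → 1 ≤ arcLen i j → arcLen i j ≤ s → H i j ≡ true
    short-arc-fin i j = short-arc (toℕ i) (toℕ j)
    only-short : r ≡ 0 → ∀ i j → H i j ≡ true → arcLen i j ≤ s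
    only-short r≡0 i j e with arc-cases (toℕ i) (toℕ j) e
    ... | inj₁ (_ , d≤s) = d≤s
    ... | inj₂ (_ , c)   = contradiction (trans (sym c) (none-chosen r≡0 (toℕ i))) λ ()

-- Counting arcs and loads

∑²-arcLen-positive : ∀ p → ∑² p (λ i j → ind (0 <ᵇ arcLen i j)) ≡ p * (p ∸ 1)
∑²-arcLen-positive p = begin
  Σℕ p (λ a → Σℕ p (λ b → ind (0 <ᵇ dist p a b)))
    ≡⟨ Σℕ-cong p (λ a a<p → trans (Σℕ-dist-from p a (λ ℓ → ind (0 <ᵇ ℓ)) a<p) (Σℕ-ind> p 0)) ⟩
  Σℕ p (λ _ → p ∸ 1) ≡⟨ ∑-const p (p ∸ 1) ⟩
  p * (p ∸ 1) ∎
  where open ≡-Reasoning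

module _ {p} (H : Digraph p) where

  twice-arcs : 2 * arcs H ≡ ∑² p (λ i j → ind (H i j) + ind (H j i))
  twice-arcs = begin
    2 * arcs H                   ≡⟨ cong (λ n → n + (n + 0)) (arcs≡∑² H) ⟩
    A + (A + 0)                  ≡⟨ cong (A +_) (trans (+-identityʳ A) (∑-comm {p} {p} (λ i j → ind (H i j)))) ⟩
    A + ∑² p (λ i j → ind (H j i)) ≡⟨ ∑²-+ p (λ i j → ind (H i j)) (λ i j → ind (H j i)) ⟨
    ∑² p (λ i j → ind (H i j) + ind (H j i)) ∎
    where
    open ≡-Reasoning
    A : ℕ
    A = ∑² p (λ i j → ind (H i j))

  pair-indicator : Oriented H → ∀ i j → ind (H i j) + ind (H j i) ≤ ind (0 <ᵇ arcLen i j)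
  pair-indicator (loop-free , antisymmetric) i j with arcLen i j in ℓ
  ... | zero rewrite arcLen≡0⇒≡ i j ℓ | loop-free j = ≤-refl
  ... | suc _ with H i j in ij | H j i in ji
  ...   | true  | true  = contradiction (trans (sym (antisymmetric i j ij)) ji) λ ()
  ...   | true  | false = ≤-refl
  ...   | false | b     = ind≤1 b

  tournament-pair-indicator : Tournament H → ∀ i j → ind (H i j) + ind (H j i) ≡ ind (0 <ᵇ arcLen i j)
  tournament-pair-indicator ((loop-free , antisymmetric) , complete) i j with arcLen i j in ℓ
  ... | zero rewrite arcLen≡0⇒≡ i j ℓ | loop-free j = refl
  ... | suc n with H i j in ij | H j i in ji
  ...   | true  | true  = contradiction (trans (sym (antisymmetric i j ij)) ji) λ ()
  ...   | true  | false = refl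
  ...   | false | true  = refl
  ...   | false | false with complete i j i≢j
    where
    i≢j : i ≢ j
    i≢j i≡j = contradiction (trans (sym ℓ) (trans (sym (cong (arcLen i) i≡j)) (dist-self p (toℕ i)))) λ ()
  ...     | inj₁ ij′ = contradiction (trans (sym ij) ij′) λ ()
  ...     | inj₂ ji′ = contradiction (trans (sym ji) ji′) λ ()

  twice-arcs-oriented : Oriented H → 2 * arcs H ≤ p * (p ∸ 1)
  twice-arcs-oriented oriented = begin
    2 * arcs H                                      ≡⟨ twice-arcs ⟩
    ∑² p (λ i j → ind (H i j) + ind (H j i))        ≤⟨ ∑²-mono-≤ p (pair-indicator oriented) ⟩
    ∑² p (λ i j → ind (0 <ᵇ arcLen i j))            ≡⟨ ∑²-arcLen-positive p ⟩
    p * (p ∸ 1)                                     ∎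
    where open ≤-Reasoning

  twice-arcs-tournament : Tournament H → 2 * arcs H ≡ p * (p ∸ 1)
  twice-arcs-tournament tournament = begin
    2 * arcs H                                      ≡⟨ twice-arcs ⟩
    ∑² p (λ i j → ind (H i j) + ind (H j i))        ≡⟨ ∑²-cong p (tournament-pair-indicator tournament) ⟩
    ∑² p (λ i j → ind (0 <ᵇ arcLen i j))            ≡⟨ ∑²-arcLen-positive p ⟩
    p * (p ∸ 1)                                     ∎
    where open ≡-Reasoning

  route-length : ∀ i j → ∑[ e < p ] ind (H i j ∧ onRoute i j e) ≡ ind (H i j) * arcLen i j
  route-length i j = begin
    ∑[ e < p ] ind (H i j ∧ onRoute i j e)            ≡⟨ sum-cong-≗ {p} (λ e → ind-∧ (H i j) (onRoute i j e)) ⟩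
    ∑[ e < p ] (ind (H i j) * ind (onRoute i j e))    ≡⟨ *-distribˡ-sum {p} (ind (H i j)) _ ⟨
    ind (H i j) * Σℕ p (λ x → ind (dist p a x <ᵇ L))  ≡⟨ cong (ind (H i j) *_) covered ⟩
    ind (H i j) * L                                   ∎
    where
    open ≡-Reasoning
    a : ℕ
    a = toℕ i
    L : ℕ
    L = arcLen i j
    covered : Σℕ p (λ x → ind (dist p a x <ᵇ L)) ≡ L
    covered = trans (Σℕ-dist-from p a (λ ℓ → ind (ℓ <ᵇ L)) (toℕ<n i))
                    (Σℕ-ind< p L (<⇒≤ (dist<p p (toℕ<n i) (toℕ<n j))))

  sum-loads : ∑[ e < p ] load H e ≡ ∑² p (λ i j → ind (H i j) * arcLen i j)
  sum-loads = begin
    ∑[ e < p ] load H e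
      ≡⟨ sum-cong-≗ {p} (load≡∑² H) ⟩
    ∑[ e < p ] ∑² p (λ i j → ind (H i j ∧ onRoute i j e))
      ≡⟨ ∑-comm {p} {p} (λ e i → ∑[ j < p ] ind (H i j ∧ onRoute i j e)) ⟩
    ∑[ i < p ] ∑[ e < p ] ∑[ j < p ] ind (H i j ∧ onRoute i j e)
      ≡⟨ sum-cong-≗ {p} (λ i → ∑-comm {p} {p} (λ e j → ind (H i j ∧ onRoute i j e))) ⟩
    ∑² p (λ i j → ∑[ e < p ] ind (H i j ∧ onRoute i j e))
      ≡⟨ ∑²-cong p route-length ⟩
    ∑² p (λ i j → ind (H i j) * arcLen i j) ∎
    where open ≡-Reasoning

  sum-loads≤ : ∀ C → (∀ e → load H e ≤ C) → ∑[ e < p ] load H e ≤ p * C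
  sum-loads≤ C load≤C = subst (λ n → ∑[ e < p ] load H e ≤ n) (∑-const p C) (∑-mono-≤ p load≤C)

Σℕ-shortfall : ∀ p k → suc k ≤ p → Σℕ p (λ ℓ → ind (0 <ᵇ ℓ) * (suc k ∸ ℓ)) ≡ tri k
Σℕ-shortfall (suc p) k (s≤s k≤p) = trans (Σℕ-cong p (λ ℓ _ → *-identityˡ (k ∸ ℓ))) (Σℕ-tri p k k≤p)

-- Charging every arc m + (ℓ ∸ m) = ℓ + (m ∸ ℓ) instead of its length ℓ costs at most the
-- shortfall of the p · k arcs of lengths 1, …, k, which is p · tri k.
module LengthBudget {p} (H : Digraph p) (loop-free : ∀ i → H i i ≡ false) (k : ℕ) (k<p : k < p) where

  m : ℕ
  m = suc k

  h : Fin p → Fin p → ℕ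
  h i j = ind (H i j)

  excess shortfall totalLength : ℕ
  excess      = ∑² p (λ i j → h i j * (arcLen i j ∸ m))
  shortfall   = ∑² p (λ i j → (1 ∸ h i j) * (ind (0 <ᵇ arcLen i j) * (m ∸ arcLen i j)))
  totalLength = ∑² p (λ i j → h i j * arcLen i j)

  charge : ∀ i j →
    (h i j * m + h i j * (arcLen i j ∸ m)) + (1 ∸ h i j) * (ind (0 <ᵇ arcLen i j) * (m ∸ arcLen i j))
    ≡ h i j * arcLen i j + ind (0 <ᵇ arcLen i j) * (m ∸ arcLen i j)
  charge i j with H i j in ij
  ... | false = +-identityʳ _
  ... | true with arcLen i j in ℓ
  ...   | zero = contradiction (trans (sym ij) (subst (λ j → H i j ≡ false) (arcLen≡0⇒≡ i j ℓ) (loop-free i))) λ ()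
  ...   | suc d = begin
    (1 * m + 1 * (suc d ∸ m)) + 0   ≡⟨ +-identityʳ _ ⟩
    1 * m + 1 * (suc d ∸ m)         ≡⟨ cong₂ _+_ (*-identityˡ m) (*-identityˡ (suc d ∸ m)) ⟩
    m + (suc d ∸ m)                 ≡⟨ m+[n∸m]≡n+[m∸n] m (suc d) ⟩
    suc d + (m ∸ suc d)             ≡⟨ cong₂ _+_ (*-identityˡ (suc d)) (*-identityˡ (m ∸ suc d)) ⟨
    1 * suc d + 1 * (m ∸ suc d)     ∎
    where open ≡-Reasoning

  budget : m * arcs H + excess + shortfall ≡ totalLength + p * tri k
  budget = begin
    m * arcs H + excess + shortfall
      ≡⟨ cong (λ n → n + excess + shortfall) (trans (cong (m *_) (arcs≡∑² H)) (*-comm m _)) ⟩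
    ∑² p h * m + excess + shortfall
      ≡⟨ cong (λ n → n + excess + shortfall) (∑²-*ʳ p h m) ⟨
    ∑² p (λ i j → h i j * m) + excess + shortfall
      ≡⟨ cong (_+ shortfall) (∑²-+ p (λ i j → h i j * m) _) ⟨
    ∑² p (λ i j → h i j * m + h i j * (arcLen i j ∸ m)) + shortfall
      ≡⟨ ∑²-+ p (λ i j → h i j * m + h i j * (arcLen i j ∸ m)) _ ⟨
    ∑² p (λ i j → (h i j * m + h i j * (arcLen i j ∸ m))
                  + (1 ∸ h i j) * (ind (0 <ᵇ arcLen i j) * (m ∸ arcLen i j)))
      ≡⟨ ∑²-cong p charge ⟩
    ∑² p (λ i j → h i j * arcLen i j + ind (0 <ᵇ arcLen i j) * (m ∸ arcLen i j))
      ≡⟨ ∑²-+ p (λ i j → h i j * arcLen i j) _ ⟩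
    totalLength + Σℕ p (λ a → Σℕ p (λ b → ind (0 <ᵇ dist p a b) * (m ∸ dist p a b)))
      ≡⟨ cong (totalLength +_) (trans (Σℕ-cong p per-vertex) (∑-const p (tri k))) ⟩
    totalLength + p * tri k ∎
    where
    open ≡-Reasoning
    per-vertex : ∀ a → a < p → Σℕ p (λ b → ind (0 <ᵇ dist p a b) * (m ∸ dist p a b)) ≡ tri k
    per-vertex a a<p = trans (Σℕ-dist-from p a (λ ℓ → ind (0 <ᵇ ℓ) * (m ∸ ℓ)) a<p) (Σℕ-shortfall p k k<p)

  totalLength≡sum-loads : totalLength ≡ ∑[ e < p ] load H e
  totalLength≡sum-loads = sym (sum-loads H)

arcs≤ : ∀ {p} C k r (H : Digraph p) → C ≡ tri k + r → k < p → Admissible C H →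
        arcs H ≤ k * p + (r * p) / suc k
arcs≤ {p} C k r H C≡ k<p ((loop-free , _) , load≤C) =
  m*n≤m*a+b⇒n≤a+b/m (suc k) (k * p) (r * p) (arcs H) (begin
    suc k * arcs H                         ≤⟨ ≤-trans (m≤m+n _ excess) (m≤m+n _ shortfall) ⟩
    suc k * arcs H + excess + shortfall    ≡⟨ budget ⟩
    totalLength + p * tri k                ≤⟨ +-monoˡ-≤ (p * tri k) totalLength≤ ⟩
    p * C + p * tri k                      ≡⟨ cong (λ c → p * c + p * tri k) C≡ ⟩
    p * (tri k + r) + p * tri k            ≡⟨ regroup p (tri k) r ⟩
    p * (tri k + tri k) + r * p            ≡⟨ cong (λ t → p * t + r * p) (tri-double k) ⟩
    p * (k * suc k) + r * p                ≡⟨ cong (_+ r * p) (commute p k) ⟩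
    suc k * (k * p) + r * p                ∎)
  where
  open LengthBudget H loop-free k k<p
  open ≤-Reasoning
  totalLength≤ : totalLength ≤ p * C
  totalLength≤ = subst (_≤ p * C) (sym totalLength≡sum-loads) (sum-loads≤ H C load≤C)
  regroup : ∀ p t r → p * (t + r) + p * t ≡ p * (t + t) + r * p
  regroup = solve-∀
  commute : ∀ p k → p * (k * suc k) ≡ suc k * (k * p)
  commute = solve-∀

arcs≤p[p-1]/2 : ∀ {p} C (H : Digraph p) → Admissible C H → arcs H ≤ (p * (p ∸ 1)) / 2
arcs≤p[p-1]/2 {p} C H (oriented , _) =
  subst (_≤ (p * (p ∸ 1)) / 2) ([2*n]/2≡n (arcs H)) (/-monoˡ-≤ 2 (twice-arcs-oriented H oriented))

arcs-tournament : ∀ {p} (H : Digraph p) → Tournament H → arcs H ≡ (p * (p ∸ 1)) / 2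
arcs-tournament {p} H tournament = trans (sym ([2*n]/2≡n (arcs H))) (cong (_/ 2) (twice-arcs-tournament H tournament))

-- Equality in the length budget makes every load equal to C, puts every arc of length at most k
-- into H and no arc longer than k + 1, so loads differ only by the diameters covering them.
module Case2UpperBound {p} (C k r : ℕ) (H : Digraph p)
  (1≤r : 1 ≤ r) (p≡ : p ≡ suc k + suc k) (C≡ : C ≡ tri k + r)
  (admissible : Admissible C H) (many : k * p + 2 * r ≤ arcs H) where

  oriented : Oriented H
  oriented = proj₁ admissible

  load≤C : ∀ e → load H e ≤ C
  load≤C = proj₂ admissible

  k<p : k < p
  k<p = subst (k <_) (sym p≡) (m≤m+n (suc k) (suc k))

  open LengthBudget H (proj₁ oriented) k k<p

  m<p : m < p
  m<p = subst (m <_) (sym p≡) (m<m+n m {m} z<s)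

  many′ : p * C + p * tri k ≤ m * arcs H
  many′ = subst (_≤ m * arcs H) identity (*-monoʳ-≤ m many)
    where
    identity : m * (k * p + 2 * r) ≡ p * C + p * tri k
    identity = begin
      m * (k * p + 2 * r)                       ≡⟨ cong (λ q → m * (k * q + 2 * r)) p≡ ⟩
      m * (k * (m + m) + 2 * r)                 ≡⟨ regroup m k r ⟩
      (m + m) * (k * m) + (m + m) * r           ≡⟨ cong (λ t → (m + m) * t + (m + m) * r) (tri-double k) ⟨
      (m + m) * (tri k + tri k) + (m + m) * r   ≡⟨ regroup′ (m + m) (tri k) r ⟩
      (m + m) * (tri k + r) + (m + m) * tri k   ≡⟨ cong₂ (λ q c → q * c + q * tri k) (sym p≡) (sym C≡) ⟩
      p * C + p * tri k                         ∎
      where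
      open ≡-Reasoning
      regroup : ∀ m k r → m * (k * (m + m) + 2 * r) ≡ (m + m) * (k * m) + (m + m) * r
      regroup = solve-∀
      regroup′ : ∀ q t r → q * (t + t) + q * r ≡ q * (t + r) + q * t
      regroup′ = solve-∀

  totalLength≤ : totalLength ≤ p * C
  totalLength≤ = subst (_≤ p * C) (sym totalLength≡sum-loads) (sum-loads≤ H C load≤C)

  budget≤ : m * arcs H + (excess + shortfall) ≤ m * arcs H
  budget≤ = begin
    m * arcs H + (excess + shortfall)   ≡⟨ +-assoc (m * arcs H) excess shortfall ⟨
    m * arcs H + excess + shortfall     ≡⟨ budget ⟩
    totalLength + p * tri k             ≤⟨ +-monoˡ-≤ (p * tri k) totalLength≤ ⟩
    p * C + p * tri k                   ≤⟨ many′ ⟩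
    m * arcs H                          ∎
    where open ≤-Reasoning

  excess+shortfall≡0 : excess + shortfall ≡ 0
  excess+shortfall≡0 = m+n≤m⇒n≡0 (m * arcs H) (excess + shortfall) budget≤

  sum-loads-full : p * C ≤ ∑[ e < p ] load H e
  sum-loads-full = +-cancelʳ-≤ (p * tri k) (p * C) (∑[ e < p ] load H e) (begin
    p * C + p * tri k                   ≤⟨ many′ ⟩
    m * arcs H                          ≤⟨ ≤-trans (m≤m+n _ excess) (m≤m+n _ shortfall) ⟩
    m * arcs H + excess + shortfall     ≡⟨ budget ⟩
    totalLength + p * tri k             ≡⟨ cong (_+ p * tri k) totalLength≡sum-loads ⟩
    ∑[ e < p ] load H e + p * tri k     ∎)
    where open ≤-Reasoning

  arcs-at-most-diameter : ∀ i j → H i j ≡ true → arcLen i j ≤ m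
  arcs-at-most-diameter i j ij = m∸n≡0⇒m≤n (begin
    arcLen i j ∸ m                  ≡⟨ *-identityˡ (arcLen i j ∸ m) ⟨
    1 * (arcLen i j ∸ m)            ≡⟨ cong (λ b → ind b * (arcLen i j ∸ m)) ij ⟨
    ind (H i j) * (arcLen i j ∸ m)  ≡⟨ ∑²-zero p _ (m+n≡0⇒m≡0 excess excess+shortfall≡0) i j ⟩
    0                               ∎)
    where open ≡-Reasoning

  short-arcs-present : ∀ i j → 1 ≤ arcLen i j → arcLen i j ≤ k → H i j ≡ true
  short-arcs-present i j 1≤ℓ ℓ≤k with H i j in ij
  ... | true  = refl
  ... | false = contradiction (m∸n≡0⇒m≤n m∸ℓ≡0) (<⇒≱ (s≤s ℓ≤k))
    where
    missing : (1 ∸ ind (H i j)) * (ind (0 <ᵇ arcLen i j) * (m ∸ arcLen i j)) ≡ 0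
    missing = ∑²-zero p _ (m+n≡0⇒n≡0 excess excess+shortfall≡0) i j
    m∸ℓ≡0 : m ∸ arcLen i j ≡ 0
    m∸ℓ≡0 = begin
      m ∸ ℓ                                       ≡⟨ *-identityˡ (m ∸ ℓ) ⟨
      1 * (m ∸ ℓ)                                 ≡⟨ cong (λ b → ind b * (m ∸ ℓ)) (<ᵇ-true 1≤ℓ) ⟨
      ind (0 <ᵇ ℓ) * (m ∸ ℓ)                      ≡⟨ *-identityˡ _ ⟨
      (1 ∸ ind false) * (ind (0 <ᵇ ℓ) * (m ∸ ℓ))  ≡⟨ cong (λ b → (1 ∸ ind b) * (ind (0 <ᵇ ℓ) * (m ∸ ℓ))) ij ⟨
      (1 ∸ ind (H i j)) * (ind (0 <ᵇ ℓ) * (m ∸ ℓ)) ≡⟨ missing ⟩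
      0                                           ∎
      where
      open ≡-Reasoning
      ℓ : ℕ
      ℓ = arcLen i j

  positive-length : ∀ i j → H i j ≡ true → 1 ≤ arcLen i j
  positive-length i j ij = n≢0⇒n>0 λ ℓ≡0 →
    contradiction (trans (sym ij) (subst (λ j → H i j ≡ false) (arcLen≡0⇒≡ i j ℓ≡0) (proj₁ oriented i))) λ ()

  short-or-diameter : ∀ i j → ind (H i j) ≡ ind (isShort k (arcLen i j)) + ind (H i j ∧ (arcLen i j ≡ᵇ m))
  short-or-diameter i j with H i j in ij
  ... | false with isShort k (arcLen i j) in short
  ...   | false = refl
  ...   | true  = contradiction
          (trans (sym (short-arcs-present i j (proj₁ (isShort-sound k _ short)) (proj₂ (isShort-sound k _ short)))) ij)
          λ ()
  short-or-diameter i j | true with arcLen i j ≤? k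
  ... | yes ℓ≤k rewrite isShort-complete {k} (positive-length i j ij) ℓ≤k | ≡ᵇ-false (<⇒≢ (s≤s ℓ≤k)) = refl
  ... | no ℓ≰k  rewrite isShort-false (≰⇒> ℓ≰k)
                      | ≡ᵇ-true (≤-antisym (arcs-at-most-diameter i j ij) (≰⇒> ℓ≰k)) = refl

  diameterLoad : Fin p → ℕ
  diameterLoad e = ∑² p (λ i j → ind (H i j ∧ (arcLen i j ≡ᵇ m)) * ind (onRoute i j e))

  load-split : ∀ e → load H e ≡ tri k + diameterLoad e
  load-split e = begin
    load H e                                      ≡⟨ load≡∑² H e ⟩
    ∑² p (λ i j → ind (H i j ∧ onRoute i j e))    ≡⟨ ∑²-cong p split ⟩
    ∑² p (λ i j → short i j + diameter i j)       ≡⟨ ∑²-+ p short diameter ⟩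
    ∑² p short + diameterLoad e                   ≡⟨ cong (_+ diameterLoad e) (short-load p k (toℕ e) k<p (toℕ<n e)) ⟩
    tri k + diameterLoad e                        ∎
    where
    open ≡-Reasoning
    short diameter : Fin p → Fin p → ℕ
    short i j = ind (isShort k (arcLen i j)) * ind (onRoute i j e)
    diameter i j = ind (H i j ∧ (arcLen i j ≡ᵇ m)) * ind (onRoute i j e)
    split : ∀ i j → ind (H i j ∧ onRoute i j e) ≡ short i j + diameter i j
    split i j = trans (ind-∧ (H i j) (onRoute i j e))
      (trans (cong (_* ind (onRoute i j e)) (short-or-diameter i j))
             (*-distribʳ-+ (ind (onRoute i j e)) (ind (isShort k (arcLen i j))) _))

  diameterLoads-positive : 0 < ∑[ e < p ] diameterLoad e
  diameterLoads-positive = <-≤-trans (*-mono-≤ (<-trans z<s m<p) 1≤r) (+-cancelˡ-≤ (p * tri k) (p * r) _ (begin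
    p * tri k + p * r                            ≡⟨ *-distribˡ-+ p (tri k) r ⟨
    p * (tri k + r)                              ≡⟨ cong (p *_) C≡ ⟨
    p * C                                        ≤⟨ sum-loads-full ⟩
    ∑[ e < p ] load H e                          ≡⟨ sum-cong-≗ {p} load-split ⟩
    ∑[ e < p ] (tri k + diameterLoad e)          ≡⟨ ∑-distrib-+ {p} (λ _ → tri k) diameterLoad ⟩
    ∑[ e < p ] tri k + ∑[ e < p ] diameterLoad e ≡⟨ cong (_+ ∑[ e < p ] diameterLoad e) (∑-const p (tri k)) ⟩
    p * tri k + ∑[ e < p ] diameterLoad e        ∎))
    where open ≤-Reasoning

  some-diameter : ∃ λ i → ∃ λ j → H i j ≡ true × arcLen i j ≡ m
  some-diameter with ∑>0⇒∃>0 p diameterLoad diameterLoads-positive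
  ... | e , De>0 with ∑²-positive p _ De>0
  ...   | i , j , Fij>0 with H i j ∧ (arcLen i j ≡ᵇ m) in d
  ...     | true  = i , j , proj₁ (∧-true d) , ≡ᵇ-sound (proj₂ (∧-true {H i j} d))
  ...     | false = contradiction Fij>0 λ ()

  module Diameter (ia jb : Fin p) (ab : H ia jb ≡ true) (ab-diameter : arcLen ia jb ≡ m) where

    a : ℕ
    a = toℕ ia
    a<p : a < p
    a<p = toℕ<n ia

    before : Fin p
    before = fromℕ< (cyclePred<p a<p)

    m≤p∸1 : m ≤ p ∸ 1
    m≤p∸1 = subst (λ q → m ≤ q ∸ 1) (sym p≡) (m≤n+m m k)

    -- A diameter covering the cycle arc before a but not the one at a would end at a, so it
    -- would be the reverse of the diameter (a, b).
    still-covered : ∀ i j → H i j ≡ true → arcLen i j ≡ m → onRoute i j before ≡ true → onRoute i j ia ≡ true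
    still-covered i j ij ℓ≡m covers = <ᵇ-true (subst (dist p x a <_) (sym ℓ≡m) (≤∧≢⇒< xa≤m xa≢m))
      where
      x : ℕ
      x = toℕ i
      x<p : x < p
      x<p = toℕ<n i
      y<m : dist p x (cyclePred p a) < m
      y<m = subst₂ (λ z ℓ → dist p x z < ℓ) (toℕ-fromℕ< (cyclePred<p a<p)) ℓ≡m (<ᵇ-sound covers)
      x≢a : x ≢ a
      x≢a x≡a = <⇒≱ y<m (subst (m ≤_) (sym (trans (cong (λ z → dist p z (cyclePred p a)) x≡a)
                                                   (dist-cyclePred-self p a a<p))) m≤p∸1)
      xa≤m : dist p x a ≤ m
      xa≤m = subst (_≤ m) (dist-cyclePred p x a x<p a<p x≢a) y<m
      xa≢m : dist p x a ≢ m
      xa≢m xa≡m = contradiction (subst₂ (λ u v → H u v ≡ true) i≡jb j≡ia ij)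
                                (λ ba → contradiction (trans (sym (proj₂ oriented ia jb ab)) ba) λ ())
        where
        j≡ia : j ≡ ia
        j≡ia = toℕ-injective (dist-injectiveʳ p {x} (toℕ<n j) a<p (trans ℓ≡m (sym xa≡m)))
        ax≡m : dist p a x ≡ m
        ax≡m = +-cancelˡ-≡ m (dist p a x) m (trans (cong (_+ dist p a x) (sym xa≡m))
                                                   (trans (dist-complement p x<p a<p x≢a) p≡))
        i≡jb : i ≡ jb
        i≡jb = toℕ-injective (dist-injectiveʳ p {a} x<p (toℕ<n jb) (trans ax≡m (sym ab-diameter)))

    diameterLoad-drops : diameterLoad before < diameterLoad ia
    diameterLoad-drops = ∑²-mono-< p covered-before⇒covered ia jb drops-here
      where
      covered-before⇒covered : ∀ i j → ind (H i j ∧ (arcLen i j ≡ᵇ m)) * ind (onRoute i j before)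
                                     ≤ ind (H i j ∧ (arcLen i j ≡ᵇ m)) * ind (onRoute i j ia)
      covered-before⇒covered i j with H i j ∧ (arcLen i j ≡ᵇ m) in d
      ... | false = z≤n
      ... | true with onRoute i j before in covers
      ...   | false = z≤n
      ...   | true rewrite still-covered i j (proj₁ (∧-true d)) (≡ᵇ-sound (proj₂ (∧-true {H i j} d))) covers = ≤-refl
      drops-here : ind (H ia jb ∧ (arcLen ia jb ≡ᵇ m)) * ind (onRoute ia jb before)
                 < ind (H ia jb ∧ (arcLen ia jb ≡ᵇ m)) * ind (onRoute ia jb ia)
      drops-here rewrite ab | ab-diameter | ≡ᵇ-true {m} refl | toℕ-fromℕ< (cyclePred<p a<p)
                       | dist-cyclePred-self p a a<p | <ᵇ-false m≤p∸1 | dist-self p a = s≤s z≤n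

    impossible : ⊥
    impossible = <⇒≱ sum-loads<pC sum-loads-full
      where
      load-drops : load H before < load H ia
      load-drops = subst₂ _<_ (sym (load-split before)) (sym (load-split ia)) (+-monoʳ-< (tri k) diameterLoad-drops)
      sum-loads<pC : ∑[ e < p ] load H e < p * C
      sum-loads<pC = <-≤-trans (∑-mono-< p {load H} {λ _ → C} load≤C before (<-≤-trans load-drops (load≤C ia)))
                               (≤-reflexive (∑-const p C))

  impossible : ⊥
  impossible = let (ia , jb , ab , ab-diameter) = some-diameter in Diameter.impossible ia jb ab ab-diameter

-- 0/1 sequences without two consecutive ones

Sparse : (ℕ → ℕ) → Set
Sparse f = (∀ j → f j ≤ 1) × (∀ j → f j ≡ 1 → f (suc j) ≡ 0)

sparse-shift : ∀ t {f} → Sparse f → Sparse (λ j → f (t + j))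
sparse-shift t {f} (bits , gap) =
  (λ j → bits (t + j)) , (λ j e → subst (λ z → f z ≡ 0) (sym (+-suc t j)) (gap (t + j) e))

sparse-mask : ∀ {f} (b : ℕ → Bool) → Sparse f → Sparse (λ j → f j * ind (b j))
sparse-mask {f} b (bits , gap) =
  (λ j → *-mono-≤ (bits j) (ind≤1 (b j))) ,
  (λ j e → cong (_* ind (b (suc j))) (gap j (m*n≡1⇒m≡1 (f j) _ e)))

sparse-sum : ∀ n {f} → Sparse f → 2 * Σℕ n f ≤ n + 1
sparse-sum zero          _      = z≤n
sparse-sum (suc n) {f} sparse with f 0 in f₀ | proj₁ sparse 0
... | zero        | _ = ≤-trans (sparse-sum n (sparse-shift 1 sparse)) (n≤1+n (n + 1))
... | suc (suc _) | s≤s ()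
... | suc zero    | _ = after-one n (proj₂ sparse 0 f₀)
  where
  after-one : ∀ n → f 1 ≡ 0 → 2 * (1 + Σℕ n (f ∘ suc)) ≤ suc n + 1
  after-one zero    _  = ≤-refl
  after-one (suc n) f₁ rewrite f₁ = subst (_≤ 2 + (n + 1)) (sym (*-distribˡ-+ 2 1 (Σℕ n (f ∘ suc ∘ suc))))
                                          (+-monoʳ-≤ 2 (sparse-sum n (sparse-shift 2 sparse)))

sparse-sum-vanishing : ∀ q n {f} → Sparse f → (∀ j → n ≤ j → f j ≡ 0) → 2 * Σℕ q f ≤ n + 1
sparse-sum-vanishing q n {f} sparse vanishing with q ≤? n
... | yes q≤n = ≤-trans (sparse-sum q sparse) (+-monoˡ-≤ 1 q≤n)
... | no  q≰n = subst (λ s → 2 * s ≤ n + 1)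
                      (sym (Σℕ-truncate q n (<⇒≤ (≰⇒> q≰n)) (λ j n≤j _ → vanishing j n≤j)))
                      (sparse-sum n sparse)

sparse-sum-window : ∀ q t n {f} → Sparse f → (∀ j → j < t → f j ≡ 0) → (∀ j → n ≤ j → f j ≡ 0) →
                    2 * Σℕ q f ≤ (n ∸ t) + 1
sparse-sum-window q t n {f} sparse before after with q ≤? t
... | yes q≤t = subst (λ s → 2 * s ≤ (n ∸ t) + 1) (sym (Σℕ-zero q (λ j j<q → before j (<-≤-trans j<q q≤t)))) z≤n
... | no  q≰t = subst (λ s → 2 * s ≤ (n ∸ t) + 1) (sym inside)
      (sparse-sum-vanishing (q ∸ t) (n ∸ t) (sparse-shift t sparse)
        (λ i n∸t≤i → after (t + i) (≤-trans (m≤n+m∸n n t) (+-monoʳ-≤ t n∸t≤i))))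
  where
  t≤q : t ≤ q
  t≤q = <⇒≤ (≰⇒> q≰t)
  inside : Σℕ q f ≡ Σℕ (q ∸ t) (λ i → f (t + i))
  inside = begin
    Σℕ q f                                  ≡⟨ cong (λ n → Σℕ n f) (m+[n∸m]≡n t≤q) ⟨
    Σℕ (t + (q ∸ t)) f                      ≡⟨ Σℕ-split t (q ∸ t) f ⟩
    Σℕ t f + Σℕ (q ∸ t) (λ i → f (t + i))   ≡⟨ cong (_+ Σℕ (q ∸ t) (λ i → f (t + i))) (Σℕ-zero t before) ⟩
    Σℕ (q ∸ t) (λ i → f (t + i))            ∎
    where open ≡-Reasoning

-- Two consecutive ones can only occur at the switch from f to g, hence n + 2 rather than n + 1.
sparse-sum-switch : ∀ q n y {f g} → Sparse f → Sparse g → (∀ j → n ≤ j → f j ≡ 0) → (∀ j → n ≤ j → g j ≡ 0) →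
                    2 * Σℕ q (λ j → f j * ind (j <ᵇ suc y) + g j * ind (y <ᵇ j)) ≤ n + 2
sparse-sum-switch q n y {f} {g} f-sparse g-sparse f-vanishing g-vanishing = begin
  2 * Σℕ q (λ j → F j + G j)        ≡⟨ cong (2 *_) (Σℕ-+ q F G) ⟩
  2 * (Σℕ q F + Σℕ q G)             ≡⟨ *-distribˡ-+ 2 (Σℕ q F) (Σℕ q G) ⟩
  2 * Σℕ q F + 2 * Σℕ q G           ≤⟨ +-mono-≤ first second ⟩
  (u + 1) + ((n ∸ suc y) + 1)       ≡⟨ total ⟩
  n + 2                             ∎
  where
  open ≤-Reasoning
  F G : ℕ → ℕ
  F j = f j * ind (j <ᵇ suc y)
  G j = g j * ind (y <ᵇ j)
  F-from-switch : ∀ j → suc y ≤ j → F j ≡ 0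
  F-from-switch j y<j = trans (cong (λ b → f j * ind b) (<ᵇ-false y<j)) (*-zeroʳ (f j))
  F-from-n : ∀ j → n ≤ j → F j ≡ 0
  F-from-n j n≤j = cong (_* ind (j <ᵇ suc y)) (f-vanishing j n≤j)
  second : 2 * Σℕ q G ≤ (n ∸ suc y) + 1
  second = sparse-sum-window q (suc y) n (sparse-mask (y <ᵇ_) g-sparse)
    (λ j j≤y → trans (cong (λ b → g j * ind b) (<ᵇ-false (s≤s⁻¹ j≤y))) (*-zeroʳ (g j)))
    (λ j n≤j → cong (_* ind (y <ᵇ j)) (g-vanishing j n≤j))
  u : ℕ
  u = suc y ⊓ n
  first : 2 * Σℕ q F ≤ u + 1
  first with ⊓-sel (suc y) n
  ... | inj₁ u≡ = subst (λ v → 2 * Σℕ q F ≤ v + 1) (sym u≡)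
                        (sparse-sum-vanishing q (suc y) (sparse-mask (_<ᵇ suc y) f-sparse) F-from-switch)
  ... | inj₂ u≡ = subst (λ v → 2 * Σℕ q F ≤ v + 1) (sym u≡)
                        (sparse-sum-vanishing q n (sparse-mask (_<ᵇ suc y) f-sparse) F-from-n)
  total : (u + 1) + ((n ∸ suc y) + 1) ≡ n + 2
  total = trans (regroup u (n ∸ suc y)) (cong (_+ 2) (m⊓n+n∸m≡n (suc y) n))
    where
    regroup : ∀ a b → (a + 1) + (b + 1) ≡ (a + b) + 2
    regroup = solve-∀

-- Choosing diameters by parity

isEven : ℕ → Bool
isEven zero    = true
isEven (suc n) = not (isEven n)

ind≡1⇒true : ∀ {x} → ind x ≡ 1 → x ≡ true
ind≡1⇒true {true} _ = refl

alternating-sparse : ∀ (b par : ℕ → Bool) → (∀ j → par (suc j) ≡ not (par j)) → Sparse (λ j → ind (b j ∧ par j))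
alternating-sparse b par alternates = (λ j → ind≤1 (b j ∧ par j)) , gap
  where
  gap : ∀ j → ind (b j ∧ par j) ≡ 1 → ind (b (suc j) ∧ par (suc j)) ≡ 0
  gap j e rewrite alternates j | proj₂ (∧-true {b j} (ind≡1⇒true e)) = cong ind (∧-zeroʳ (b (suc j)))

-- Of the first n antipodal pairs {j, q + j} (q = s + 1) the diameter leaves j for even j and
-- q + j for odd j: no two chosen diameters are antiparallel, and the tails covering a cycle arc
-- come from two sequences without consecutive ones.
module ParityChoice (s n p : ℕ) (p≡ : p ≡ suc s + suc s) (n≤q : n ≤ suc s) where

  q : ℕ
  q = suc s

  chosen : ℕ → Bool
  chosen a = if a <ᵇ q then (a <ᵇ n) ∧ isEven a else ((a ∸ q) <ᵇ n) ∧ not (isEven (a ∸ q))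

  q<p : q < p
  q<p = subst (q <_) (sym p≡) (m<m+n q {q} z<s)

  open Circulant p s chosen q<p public

  chosen-low : ∀ j → j < q → chosen j ≡ (j <ᵇ n) ∧ isEven j
  chosen-low j j<q rewrite <ᵇ-true j<q = refl

  chosen-high : ∀ j → chosen (q + j) ≡ (j <ᵇ n) ∧ not (isEven j)
  chosen-high j rewrite <ᵇ-false (m≤m+n q j) | m+n∸m≡n q j = refl

  evenPairs oddPairs : ℕ → ℕ
  evenPairs j = ind ((j <ᵇ n) ∧ isEven j)
  oddPairs  j = ind ((j <ᵇ n) ∧ not (isEven j))

  evenPairs-sparse : Sparse evenPairs
  evenPairs-sparse = alternating-sparse (_<ᵇ n) isEven (λ _ → refl)

  oddPairs-sparse : Sparse oddPairs
  oddPairs-sparse = alternating-sparse (_<ᵇ n) (not ∘ isEven) (λ _ → refl)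

  evenPairs-vanishing : ∀ j → n ≤ j → evenPairs j ≡ 0
  evenPairs-vanishing j n≤j rewrite <ᵇ-false n≤j = refl

  oddPairs-vanishing : ∀ j → n ≤ j → oddPairs j ≡ 0
  oddPairs-vanishing j n≤j rewrite <ᵇ-false n≤j = refl

  q≤p∸j : ∀ {j} → j < q → q ≤ p ∸ j
  q≤p∸j {j} j<q = subst (λ r → q ≤ r ∸ j) (sym p≡) (subst (q ≤_) (sym (+-∸-assoc q (<⇒≤ j<q))) (m≤m+n q (q ∸ j)))

  module _ {j x : ℕ} (j<q : j < q) (x<q : x < q) where

    within-first-half : (dist p j x <ᵇ q) ≡ (j <ᵇ suc x)
    within-first-half with j ≤? x
    ... | yes j≤x rewrite dist-≤ p j≤x | <ᵇ-true (s≤s j≤x) = <ᵇ-true (≤-<-trans (m∸n≤m x j) x<q)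
    ... | no  j≰x rewrite dist-> p (≰⇒> j≰x) | <ᵇ-false (≰⇒> j≰x) = <ᵇ-false (≤-trans (q≤p∸j j<q) (m≤m+n (p ∸ j) x))

    from-second-half : (dist p (q + j) x <ᵇ q) ≡ (x <ᵇ j)
    from-second-half rewrite dist-> p {q + j} {x} (≤-trans x<q (m≤m+n q j)) | p≡ | [m+n]∸[m+o]≡n∸o q q j
      with x <? j
    ... | yes x<j rewrite <ᵇ-true x<j =
      <ᵇ-true (subst ((q ∸ j) + x <_) (m∸n+n≡m (<⇒≤ j<q)) (+-monoʳ-< (q ∸ j) x<j))
    ... | no  x≮j rewrite <ᵇ-false (≮⇒≥ x≮j) =
      <ᵇ-false (subst (_≤ (q ∸ j) + x) (m∸n+n≡m (<⇒≤ j<q)) (+-monoʳ-≤ (q ∸ j) (≮⇒≥ x≮j)))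

    into-second-half : (dist p j (q + x) <ᵇ q) ≡ (x <ᵇ j)
    into-second-half rewrite dist-≤ p (≤-trans (<⇒≤ j<q) (m≤m+n q x)) with x <? j
    ... | yes x<j rewrite <ᵇ-true x<j =
      <ᵇ-true (m<n+o⇒m∸n<o (q + x) j (subst (q + x <_) (+-comm q j) (+-monoʳ-< q x<j)))
    ... | no  x≮j rewrite <ᵇ-false (≮⇒≥ x≮j) = <ᵇ-false (m+n≤o⇒m≤o∸n q (+-monoʳ-≤ q (≮⇒≥ x≮j)))

    within-second-half : (dist p (q + j) (q + x) <ᵇ q) ≡ (j <ᵇ suc x)
    within-second-half with j ≤? x
    ... | yes j≤x rewrite dist-≤ p (+-monoʳ-≤ q j≤x) | <ᵇ-true (s≤s j≤x) | [m+n]∸[m+o]≡n∸o q x j =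
      <ᵇ-true (≤-<-trans (m∸n≤m x j) x<q)
    ... | no  j≰x rewrite dist-> p (+-monoʳ-< q (≰⇒> j≰x)) | <ᵇ-false (≰⇒> j≰x) | p≡ | [m+n]∸[m+o]≡n∸o q q j =
      <ᵇ-false (≤-trans (m≤m+n q x) (m≤n+m (q + x) (q ∸ j)))

  halves : ∀ (F : ℕ → ℕ) → Σℕ p F ≡ Σℕ q (λ j → F j + F (q + j))
  halves F = begin
    Σℕ p F                                ≡⟨ cong (λ r → Σℕ r F) p≡ ⟩
    Σℕ (q + q) F                          ≡⟨ Σℕ-split q q F ⟩
    Σℕ q F + Σℕ q (λ j → F (q + j))       ≡⟨ Σℕ-+ q F (λ j → F (q + j)) ⟨
    Σℕ q (λ j → F j + F (q + j))          ∎
    where open ≡-Reasoning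

  longLoad-halves : ∀ x → longLoad x ≡
    Σℕ q (λ j → ind (chosen j) * ind (dist p j x <ᵇ q) + ind (chosen (q + j)) * ind (dist p (q + j) x <ᵇ q))
  longLoad-halves x = halves (λ a → ind (chosen a) * ind (dist p a x <ᵇ q))

  longLoad-bound : ∀ x → x < p → 2 * longLoad x ≤ n + 2
  longLoad-bound x x<p with x <? q
  ... | yes x<q = subst (λ w → 2 * w ≤ n + 2) (sym (trans (longLoad-halves x) (Σℕ-cong q pointwise)))
      (sparse-sum-switch q n x evenPairs-sparse oddPairs-sparse evenPairs-vanishing oddPairs-vanishing)
    where
    pointwise : ∀ j → j < q →
      ind (chosen j) * ind (dist p j x <ᵇ q) + ind (chosen (q + j)) * ind (dist p (q + j) x <ᵇ q)
      ≡ evenPairs j * ind (j <ᵇ suc x) + oddPairs j * ind (x <ᵇ j)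
    pointwise j j<q rewrite chosen-low j j<q | chosen-high j
                          | within-first-half j<q x<q | from-second-half j<q x<q = refl
  ... | no x≮q = subst (λ w → 2 * w ≤ n + 2) (sym (trans (longLoad-halves x) (Σℕ-cong q pointwise)))
      (sparse-sum-switch q n y oddPairs-sparse evenPairs-sparse oddPairs-vanishing evenPairs-vanishing)
    where
    y : ℕ
    y = x ∸ q
    x≡q+y : x ≡ q + y
    x≡q+y = sym (m+[n∸m]≡n (≮⇒≥ x≮q))
    y<q : y < q
    y<q = +-cancelˡ-< q y q (subst (_< q + q) x≡q+y (subst (x <_) p≡ x<p))
    pointwise : ∀ j → j < q →
      ind (chosen j) * ind (dist p j x <ᵇ q) + ind (chosen (q + j)) * ind (dist p (q + j) x <ᵇ q)
      ≡ oddPairs j * ind (j <ᵇ suc y) + evenPairs j * ind (y <ᵇ j)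
    pointwise j j<q rewrite chosen-low j j<q | chosen-high j = begin
      evenPairs j * ind (dist p j x <ᵇ q) + oddPairs j * ind (dist p (q + j) x <ᵇ q)
        ≡⟨ cong₂ (λ u v → evenPairs j * ind u + oddPairs j * ind v)
                 (trans (cong (λ z → dist p j z <ᵇ q) x≡q+y) (into-second-half j<q y<q))
                 (trans (cong (λ z → dist p (q + j) z <ᵇ q) x≡q+y) (within-second-half j<q y<q)) ⟩
      evenPairs j * ind (y <ᵇ j) + oddPairs j * ind (j <ᵇ suc y)
        ≡⟨ +-comm (evenPairs j * ind (y <ᵇ j)) (oddPairs j * ind (j <ᵇ suc y)) ⟩
      oddPairs j * ind (j <ᵇ suc y) + evenPairs j * ind (y <ᵇ j) ∎
      where open ≡-Reasoning

  chosen-count : Σℕ p (ind ∘ chosen) ≡ n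
  chosen-count = trans (halves (ind ∘ chosen)) (trans (Σℕ-cong q pair) (Σℕ-ind< q n n≤q))
    where
    pair : ∀ j → j < q → ind (chosen j) + ind (chosen (q + j)) ≡ ind (j <ᵇ n)
    pair j j<q rewrite chosen-low j j<q | chosen-high j with j <ᵇ n | isEven j
    ... | true  | true  = refl
    ... | true  | false = refl
    ... | false | _     = refl

  antipodal : ∀ a b → a < p → b < p → dist p a b ≡ q → (a < q × b ≡ q + a) ⊎ (b < q × a ≡ q + b)
  antipodal a b a<p b<p ab≡q with a ≤? b
  ... | yes a≤b = inj₁ (a<q , b≡q+a)
    where
    b≡q+a : b ≡ q + a
    b≡q+a = trans (sym (m+[n∸m]≡n a≤b)) (trans (cong (a +_) (trans (sym (dist-≤ p a≤b)) ab≡q)) (+-comm a q))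
    a<q : a < q
    a<q = +-cancelʳ-< q a q (subst (_< q + q) (trans b≡q+a (+-comm q a)) (subst (b <_) p≡ b<p))
  ... | no a≰b = inj₂ (b<q , a≡q+b)
    where
    t : ℕ
    t = p ∸ a
    t+b≡q : t + b ≡ q
    t+b≡q = trans (sym (dist-> p (≰⇒> a≰b))) ab≡q
    a≡q+b : a ≡ q + b
    a≡q+b = +-cancelˡ-≡ t a (q + b) (begin
      t + a        ≡⟨ +-comm t a ⟩
      a + t        ≡⟨ m+[n∸m]≡n (<⇒≤ a<p) ⟩
      p            ≡⟨ p≡ ⟩
      q + q        ≡⟨ cong (_+ q) t+b≡q ⟨
      t + b + q    ≡⟨ +-assoc t b q ⟩
      t + (b + q)  ≡⟨ cong (t +_) (+-comm b q) ⟩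
      t + (q + b)  ∎)
      where open ≡-Reasoning
    b<q : b < q
    b<q = subst (b <_) t+b≡q (+-monoˡ-≤ b (m<n⇒0<n∸m a<p))

  parity-clash : ∀ j → (j <ᵇ n) ∧ isEven j ≡ true → (j <ᵇ n) ∧ not (isEven j) ≡ true → ⊥
  parity-clash j even odd with isEven j | proj₂ (∧-true {j <ᵇ n} even) | proj₂ (∧-true {j <ᵇ n} odd)
  ... | true | _ | ()

  not-both-chosen : ∀ a b → a < p → b < p → dist p a b ≡ q → chosen a ≡ true → chosen b ≡ true → ⊥
  not-both-chosen a b a<p b<p ab≡q ca cb with antipodal a b a<p b<p ab≡q
  ... | inj₁ (a<q , refl) = parity-clash a (trans (sym (chosen-low a a<q)) ca) (trans (sym (chosen-high a)) cb)
  ... | inj₂ (b<q , refl) = parity-clash b (trans (sym (chosen-low b b<q)) cb) (trans (sym (chosen-high b)) ca)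

  every-diameter-chosen : n ≡ q → ∀ a b → a < p → b < p → dist p a b ≡ q → chosen a ≡ true ⊎ chosen b ≡ true
  every-diameter-chosen refl a b a<p b<p ab≡q with antipodal a b a<p b<p ab≡q
  ... | inj₁ (a<q , refl) rewrite chosen-low a a<q | chosen-high a | <ᵇ-true a<q with isEven a
  ...   | true  = inj₁ refl
  ...   | false = inj₂ refl
  every-diameter-chosen refl a b a<p b<p ab≡q | inj₂ (b<q , refl)
    rewrite chosen-low b b<q | chosen-high b | <ᵇ-true b<q with isEven b
  ...   | true  = inj₂ refl
  ...   | false = inj₁ refl

  oriented : Oriented H
  oriented = circulant-oriented s+s<p (λ _ _ → s+q<p)
    (λ a b a<p b<p ab≡q _ ca cb → not-both-chosen a b a<p b<p ab≡q ca cb)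
    where
    s+q<p : s + q < p
    s+q<p = subst (s + q <_) (sym p≡) (+-monoˡ-< q (n<1+n s))
    s+s<p : s + s < p
    s+s<p = <-trans (+-monoʳ-< s (n<1+n s)) s+q<p

  load≤ : ∀ c → n + 1 ≤ 2 * c → ∀ e → load H e ≤ tri s + c
  load≤ c n<2c e = subst (_≤ tri s + c) (sym (load-circulant e)) (+-monoʳ-≤ (tri s) (2*m≤2*n+1⇒m≤n (begin
    2 * longLoad (toℕ e)  ≤⟨ longLoad-bound (toℕ e) (toℕ<n e) ⟩
    n + 2                 ≡⟨ +-assoc n 1 1 ⟨
    n + 1 + 1             ≤⟨ +-monoˡ-≤ 1 n<2c ⟩
    2 * c + 1             ∎)))
    where open ≤-Reasoning

  arcs≡ : arcs H ≡ p * s + n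
  arcs≡ = trans arcs-circulant (cong (p * s +_) chosen-count)

  tournament : n ≡ q → Tournament H
  tournament n≡q = circulant-tournament oriented covered
    where
    covered : ∀ a b → a < p → b < p → a ≢ b →
      (dist p a b ≤ s ⊎ dist p b a ≤ s) ⊎ ((dist p a b ≡ q × chosen a ≡ true) ⊎ (dist p b a ≡ q × chosen b ≡ true))
    covered a b a<p b<p a≢b with <-cmp (dist p a b) q
    ... | tri< ab<q _ _ = inj₁ (inj₁ (s≤s⁻¹ ab<q))
    ... | tri> _ _ ab>q = inj₁ (inj₂ (s≤s⁻¹ (+-cancelˡ-< (dist p a b) (dist p b a) q (begin-strict
      dist p a b + dist p b a  ≡⟨ trans (dist-complement p a<p b<p a≢b) p≡ ⟩
      q + q                    <⟨ +-monoˡ-< q ab>q ⟩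
      dist p a b + q           ∎))))
      where open ≤-Reasoning
    ... | tri≈ _ ab≡q _ with every-diameter-chosen n≡q a b a<p b<p ab≡q
    ...   | inj₁ ca = inj₂ (inj₁ (ab≡q , ca))
    ...   | inj₂ cb = inj₂ (inj₂ (ba≡q , cb))
      where
      ba≡q : dist p b a ≡ q
      ba≡q = +-cancelˡ-≡ q (dist p b a) q
        (trans (cong (_+ dist p b a) (sym ab≡q)) (trans (dist-complement p a<p b<p a≢b) p≡))

-- Choosing long arcs along a Sturmian sequence

-- The long arc out of a is present iff ⌊(a + 1) r / m⌋ > ⌊a r / m⌋, so exactly ⌊x r / m⌋ of
-- the first x vertices are chosen and every m consecutive vertices contain r chosen ones.
module SturmianChoice (s r p : ℕ) (r≤s : r ≤ s) (2m≤p : suc s + suc s ≤ p) where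

  m : ℕ
  m = suc s

  m<p : m < p
  m<p = ≤-trans (m<m+n m {m} z<s) 2m≤p

  m≤p : m ≤ p
  m≤p = <⇒≤ m<p

  chosen : ℕ → Bool
  chosen a = (a * r) / m <ᵇ (suc a * r) / m

  open Circulant p s chosen m<p public

  floor-mono : ∀ a → (a * r) / m ≤ (suc a * r) / m
  floor-mono a = /-monoˡ-≤ m (m≤n+m (a * r) r)

  floor-step : ∀ a → (suc a * r) / m ≤ suc ((a * r) / m)
  floor-step a = begin
    (suc a * r) / m      ≤⟨ /-monoˡ-≤ m (subst (r + a * r ≤_) (trans (+-comm m (a * r)) (cong (a * r +_) (sym (*-identityˡ m))))
                                            (+-monoˡ-≤ (a * r) (m≤n⇒m≤1+n r≤s))) ⟩
    (a * r + 1 * m) / m  ≡⟨ [n+a*m]/m≡n/m+a (a * r) 1 m ⟩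
    (a * r) / m + 1      ≡⟨ +-comm _ 1 ⟩
    suc ((a * r) / m)    ∎
    where open ≤-Reasoning

  ind-chosen : ∀ a → ind (chosen a) ≡ (suc a * r) / m ∸ (a * r) / m
  ind-chosen a with (a * r) / m <? (suc a * r) / m
  ... | yes jump rewrite <ᵇ-true jump | ≤-antisym (floor-step a) jump = sym (m+n∸n≡m 1 ((a * r) / m))
  ... | no flat  rewrite <ᵇ-false (≮⇒≥ flat) = sym (m≤n⇒m∸n≡0 (≮⇒≥ flat))

  prefix-count : ∀ x → Σℕ x (ind ∘ chosen) ≡ (x * r) / m
  prefix-count zero    = refl
  prefix-count (suc x) = trans (Σℕ-snoc x (ind ∘ chosen))
    (trans (cong₂ _+_ (prefix-count x) (ind-chosen x)) (m+[n∸m]≡n (floor-mono x)))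

  count-below : ∀ y → y ≤ p → Σℕ p (λ a → ind (chosen a) * ind (a <ᵇ y)) ≡ (y * r) / m
  count-below y y≤p = trans (Σℕ-cut p y (ind ∘ chosen) y≤p) (prefix-count y)

  window-no-wrap : ∀ x a → a < p → m ≤ suc x →
                   ind (dist p a x <ᵇ m) + ind (a <ᵇ suc x ∸ m) ≡ ind (a <ᵇ suc x)
  window-no-wrap x a a<p m≤x+1 with a ≤? x
  ... | yes a≤x rewrite dist-≤ p a≤x | <ᵇ-true (s≤s a≤x) with a <? suc x ∸ m
  ...   | yes early rewrite <ᵇ-true early
                          | <ᵇ-false (m+n≤o⇒m≤o∸n m (subst (_≤ x) (+-comm a m)
                              (s≤s⁻¹ (subst (suc a + m ≤_) (m∸n+n≡m m≤x+1) (+-monoˡ-≤ m early))))) = refl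
  ...   | no late  rewrite <ᵇ-false (≮⇒≥ late)
                          | <ᵇ-true (m<n+o⇒m∸n<o x a
                              (subst (_≤ a + m) (m∸n+n≡m m≤x+1) (+-monoˡ-≤ m (≮⇒≥ late)))) = refl
  window-no-wrap x a a<p m≤x+1 | no a≰x
    rewrite dist-> p (≰⇒> a≰x) | <ᵇ-false (≰⇒> a≰x)
          | <ᵇ-false {a} {suc x ∸ m} (≤-trans (m∸n≤m (suc x) m) (≰⇒> a≰x))
          | <ᵇ-false {p ∸ a + x} {m} (≤-trans m≤x+1 (+-monoˡ-≤ x (m<n⇒0<n∸m a<p))) = refl

  wrapped-far : ∀ {a x} → a < p → a < (p ∸ m) + suc x → m ≤ p ∸ a + x
  wrapped-far {a} {x} a<p before-window = +-cancelʳ-≤ a m (p ∸ a + x) (begin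
    m + a                  ≤⟨ +-monoʳ-≤ m (s≤s⁻¹ (subst (suc a ≤_) (+-suc (p ∸ m) x) before-window)) ⟩
    m + ((p ∸ m) + x)      ≡⟨ regroup m (p ∸ m) x ⟩
    ((p ∸ m) + m) + x      ≡⟨ cong (_+ x) (trans (m∸n+n≡m m≤p) (sym (m∸n+n≡m (<⇒≤ a<p)))) ⟩
    ((p ∸ a) + a) + x      ≡⟨ regroup′ (p ∸ a) a x ⟩
    (p ∸ a + x) + a        ∎)
    where
    open ≤-Reasoning
    regroup : ∀ m t x → m + (t + x) ≡ (t + m) + x
    regroup = solve-∀
    regroup′ : ∀ t a x → (t + a) + x ≡ (t + x) + a
    regroup′ = solve-∀

  wrapped-near : ∀ {a x} → a < p → (p ∸ m) + suc x ≤ a → p ∸ a + x < m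
  wrapped-near {a} {x} a<p in-window = +-cancelʳ-≤ (p ∸ m) (suc (p ∸ a + x)) m (begin
    suc (p ∸ a + x) + (p ∸ m)   ≡⟨ regroup (p ∸ a) x (p ∸ m) ⟩
    (p ∸ a) + ((p ∸ m) + suc x) ≤⟨ +-monoʳ-≤ (p ∸ a) in-window ⟩
    (p ∸ a) + a                 ≡⟨ trans (m∸n+n≡m (<⇒≤ a<p)) (sym (m∸n+n≡m m≤p)) ⟩
    (p ∸ m) + m                 ≡⟨ +-comm (p ∸ m) m ⟩
    m + (p ∸ m)                 ∎)
    where
    open ≤-Reasoning
    regroup : ∀ t x u → suc (t + x) + u ≡ t + (u + suc x)
    regroup = solve-∀

  window-wrap : ∀ x a → a < p → suc x < m →
                ind (dist p a x <ᵇ m) + ind (a <ᵇ (p ∸ m) + suc x) ≡ ind (a <ᵇ suc x) + 1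
  window-wrap x a a<p x+1<m with a ≤? x
  ... | yes a≤x rewrite dist-≤ p a≤x | <ᵇ-true (s≤s a≤x)
                      | <ᵇ-true {x ∸ a} {m} (≤-<-trans (m∸n≤m x a) (<-trans (n<1+n x) x+1<m))
                      | <ᵇ-true {a} {(p ∸ m) + suc x} (≤-trans (s≤s a≤x) (m≤n+m (suc x) (p ∸ m))) = refl
  ... | no a≰x rewrite dist-> p (≰⇒> a≰x) | <ᵇ-false (≰⇒> a≰x) with a <? (p ∸ m) + suc x
  ...   | yes before-window rewrite <ᵇ-true before-window | <ᵇ-false (wrapped-far a<p before-window) = refl
  ...   | no in-window rewrite <ᵇ-false (≮⇒≥ in-window) | <ᵇ-true (wrapped-near a<p (≮⇒≥ in-window)) = refl

  longLoad+count : ∀ x y (B : ℕ → ℕ) →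
    (∀ a → a < p → ind (dist p a x <ᵇ m) + ind (a <ᵇ y) ≡ B a) →
    longLoad x + Σℕ p (λ a → ind (chosen a) * ind (a <ᵇ y)) ≡ Σℕ p (λ a → ind (chosen a) * B a)
  longLoad+count x y B window = begin
    longLoad x + Σℕ p (λ a → F a * ind (a <ᵇ y))
      ≡⟨ Σℕ-+ p (λ a → F a * ind (dist p a x <ᵇ m)) (λ a → F a * ind (a <ᵇ y)) ⟨
    Σℕ p (λ a → F a * ind (dist p a x <ᵇ m) + F a * ind (a <ᵇ y))
      ≡⟨ Σℕ-cong p (λ a a<p → trans (sym (*-distribˡ-+ (F a) (ind (dist p a x <ᵇ m)) (ind (a <ᵇ y))))
                                    (cong (F a *_) (window a a<p))) ⟩
    Σℕ p (λ a → F a * B a) ∎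
    where
    open ≡-Reasoning
    F : ℕ → ℕ
    F a = ind (chosen a)

  longLoad-no-wrap : ∀ x → x < p → m ≤ suc x → longLoad x ≡ r
  longLoad-no-wrap x x<p m≤x+1 = +-cancelʳ-≡ ((u * r) / m) (longLoad x) r (begin
    longLoad x + (u * r) / m
      ≡⟨ cong (longLoad x +_) (count-below u (≤-trans (m∸n≤m (suc x) m) x<p)) ⟨
    longLoad x + Σℕ p (λ a → ind (chosen a) * ind (a <ᵇ u))
      ≡⟨ longLoad+count x u (λ a → ind (a <ᵇ suc x)) (λ a a<p → window-no-wrap x a a<p m≤x+1) ⟩
    Σℕ p (λ a → ind (chosen a) * ind (a <ᵇ suc x))
      ≡⟨ count-below (suc x) x<p ⟩
    (suc x * r) / m
      ≡⟨ cong (λ z → (z * r) / m) (m∸n+n≡m m≤x+1) ⟨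
    ((u + m) * r) / m
      ≡⟨ cong (_/ m) (trans (*-distribʳ-+ r u m) (cong (u * r +_) (*-comm m r))) ⟩
    (u * r + r * m) / m
      ≡⟨ [n+a*m]/m≡n/m+a (u * r) r m ⟩
    (u * r) / m + r
      ≡⟨ +-comm _ r ⟩
    r + (u * r) / m ∎)
    where
    open ≡-Reasoning
    u : ℕ
    u = suc x ∸ m

  longLoad-wrap : ∀ x → x < p → suc x < m → longLoad x ≤ r
  longLoad-wrap x x<p x+1<m = +-cancelʳ-≤ ((y * r) / m) (longLoad x) r (begin
    longLoad x + (y * r) / m
      ≡⟨ cong (longLoad x +_) (count-below y y≤p) ⟨
    longLoad x + Σℕ p (λ a → ind (chosen a) * ind (a <ᵇ y))
      ≡⟨ longLoad+count x y (λ a → ind (a <ᵇ suc x) + 1) (λ a a<p → window-wrap x a a<p x+1<m) ⟩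
    Σℕ p (λ a → ind (chosen a) * (ind (a <ᵇ suc x) + 1))
      ≡⟨ Σℕ-cong p (λ a _ → trans (*-distribˡ-+ (ind (chosen a)) _ 1)
                                  (cong (ind (chosen a) * ind (a <ᵇ suc x) +_) (*-identityʳ (ind (chosen a))))) ⟩
    Σℕ p (λ a → ind (chosen a) * ind (a <ᵇ suc x) + ind (chosen a))
      ≡⟨ Σℕ-+ p (λ a → ind (chosen a) * ind (a <ᵇ suc x)) (ind ∘ chosen) ⟩
    Σℕ p (λ a → ind (chosen a) * ind (a <ᵇ suc x)) + Σℕ p (ind ∘ chosen)
      ≡⟨ cong₂ _+_ (count-below (suc x) x<p) (prefix-count p) ⟩
    (suc x * r) / m + (p * r) / m
      ≤⟨ a/m+b/m≤[a+b]/m (suc x * r) (p * r) m ⟩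
    (suc x * r + p * r) / m
      ≡⟨ cong (_/ m) (regroup (suc x) r (p ∸ m) m (m∸n+n≡m m≤p)) ⟩
    (y * r + r * m) / m
      ≡⟨ [n+a*m]/m≡n/m+a (y * r) r m ⟩
    (y * r) / m + r
      ≡⟨ +-comm _ r ⟩
    r + (y * r) / m ∎)
    where
    open ≤-Reasoning
    y : ℕ
    y = (p ∸ m) + suc x
    y≤p : y ≤ p
    y≤p = subst (y ≤_) (m∸n+n≡m m≤p) (+-monoʳ-≤ (p ∸ m) (<⇒≤ x+1<m))
    regroup : ∀ z r t m → t + m ≡ p → z * r + p * r ≡ (t + z) * r + r * m
    regroup z r t m refl = solve-∀′ z r t m
      where
      solve-∀′ : ∀ z r t m → z * r + (t + m) * r ≡ (t + z) * r + r * m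
      solve-∀′ = solve-∀

  longLoad≤r : ∀ x → x < p → longLoad x ≤ r
  longLoad≤r x x<p with m ≤? suc x
  ... | yes m≤x+1 = ≤-reflexive (longLoad-no-wrap x x<p m≤x+1)
  ... | no  m≰x+1 = longLoad-wrap x x<p (≰⇒> m≰x+1)

  none-chosen : r ≡ 0 → ∀ a → chosen a ≡ false
  none-chosen refl a rewrite *-zeroʳ a = refl

  oriented : (p ≡ m + m → r ≡ 0) → Oriented H
  oriented antipodal-empty = circulant-oriented
    (<-≤-trans (+-mono-< (n<1+n s) (n<1+n s)) 2m≤p)
    (λ _ _ → <-≤-trans (+-monoˡ-< m (n<1+n s)) 2m≤p)
    antiparallel
    where
    antiparallel : ∀ a b → a < p → b < p → dist p a b ≡ m → dist p b a ≡ m → chosen a ≡ true → chosen b ≡ true → ⊥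
    antiparallel a b a<p b<p ab≡m ba≡m ca _ =
      contradiction (trans (sym ca) (none-chosen (antipodal-empty (sym m+m≡p)) a)) λ ()
      where
      a≢b : a ≢ b
      a≢b a≡b = contradiction (trans (sym ab≡m) (trans (cong (dist p a) (sym a≡b)) (dist-self p a))) λ ()
      m+m≡p : m + m ≡ p
      m+m≡p = trans (cong₂ _+_ (sym ab≡m) (sym ba≡m)) (dist-complement p a<p b<p a≢b)

  load≤ : ∀ e → load H e ≤ tri s + r
  load≤ e = subst (_≤ tri s + r) (sym (load-circulant e)) (+-monoʳ-≤ (tri s) (longLoad≤r (toℕ e) (toℕ<n e)))

  arcs≡ : arcs H ≡ s * p + (r * p) / m
  arcs≡ = trans arcs-circulant (cong₂ _+_ (*-comm p s) (trans (prefix-count p) (cong (_/ m) (*-comm p r))))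

-- The three cases

Extremal : ℕ → (p : ℕ) → (Digraph p → Set) → ℕ → Set
Extremal C p P v = GammaIs C p v × Σ (Digraph p) (λ H → P H × Admissible C H × arcs H ≡ v)

extremal : ∀ {C p v} {P : Digraph p → Set} (H : Digraph p) → P H → Admissible C H → arcs H ≡ v →
           (∀ H′ → Admissible C H′ → arcs H′ ≤ v) → Extremal C p P v
extremal H PH admissible arcs≡v bound = ((H , admissible , arcs≡v) , bound) , (H , PH , admissible , arcs≡v)

tournament-extremal : ∀ {C p} → (Σ (Digraph p) λ H → Tournament H × Admissible C H) →
                      Extremal C p Tournament ((p * (p ∸ 1)) / 2)
tournament-extremal {C} (H , tournament , admissible) =
  extremal H tournament admissible (arcs-tournament H tournament) (arcs≤p[p-1]/2 C)

odd-tournament : ∀ q p → p ≡ suc (q + q) → 1 ≤ q →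
                 Σ (Digraph p) λ H → Tournament H × (∀ e → load H e ≡ tri q)
odd-tournament q p p≡ 1≤q = H , circulant-tournament oriented covered , λ e → trans (load-circulant e) (no-long-arcs {toℕ e})
  where
  q+1<p : suc q < p
  q+1<p = subst (suc q <_) (sym p≡) (s≤s (m<m+n q 1≤q))
  open Circulant p q (λ _ → false) q+1<p
  oriented : Oriented H
  oriented = circulant-oriented (subst (q + q <_) (sym p≡) (n<1+n (q + q))) (λ _ ()) (λ _ _ _ _ _ _ ())
  no-long-arcs : ∀ {x} → tri q + longLoad x ≡ tri q
  no-long-arcs = trans (cong (tri q +_) (Σℕ-zero p (λ _ _ → refl))) (+-identityʳ (tri q))
  covered : ∀ a b → a < p → b < p → a ≢ b →
    (dist p a b ≤ q ⊎ dist p b a ≤ q) ⊎ ((dist p a b ≡ suc q × false ≡ true) ⊎ (dist p b a ≡ suc q × false ≡ true))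
  covered a b a<p b<p a≢b with dist p a b ≤? q
  ... | yes ab≤q = inj₁ (inj₁ ab≤q)
  ... | no  ab≰q = inj₁ (inj₂ (+-cancelˡ-≤ (dist p a b) (dist p b a) q (begin
    dist p a b + dist p b a  ≡⟨ trans (dist-complement p a<p b<p a≢b) p≡ ⟩
    suc (q + q)              ≤⟨ +-monoˡ-≤ q (≰⇒> ab≰q) ⟩
    dist p a b + q           ∎)))
    where open ≤-Reasoning

small-tournament : ∀ C k p → tri k ≤ C → 2 ≤ p → p ≤ 2 * k + 1 → Σ (Digraph p) λ H → Tournament H × Admissible C H
small-tournament C k p tri≤C 2≤p p≤2k+1 with even-or-odd p
... | inj₁ (zero , refl) = contradiction 2≤p λ ()
... | inj₁ (suc s , p≡) = H , tournament refl , oriented , λ e → ≤-trans (load≤ (suc s) s+1≤2s+2 e) tri[s+1]≤C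
  where
  open ParityChoice s (suc s) p p≡ ≤-refl
  s+1≤2s+2 : suc s + 1 ≤ 2 * suc s
  s+1≤2s+2 = +-monoʳ-≤ (suc s) (s≤s z≤n)
  s<k : s < k
  s<k = 2*m≤2*n+1⇒m≤n (subst (_≤ 2 * k + 1) (trans p≡ (cong (suc s +_) (sym (+-identityʳ (suc s))))) p≤2k+1)
  tri[s+1]≤C : tri s + suc s ≤ C
  tri[s+1]≤C = ≤-trans (≤-reflexive (+-comm (tri s) (suc s))) (≤-trans (tri-mono-≤ s<k) tri≤C)
... | inj₂ (zero , refl) = contradiction 2≤p λ { (s≤s ()) }
... | inj₂ (suc q , p≡) with odd-tournament (suc q) p p≡ (s≤s z≤n)
...   | H , tournament , load≡ =
  H , tournament , proj₁ tournament , λ e → ≤-trans (≤-reflexive (load≡ e)) (≤-trans (tri-mono-≤ q<k) tri≤C)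
  where
  q<k : suc q ≤ k
  q<k = 2*m≤2*n+1⇒m≤n (≤-trans (≤-reflexive (cong (suc q +_) (+-identityʳ (suc q))))
                                (<⇒≤ (subst (_≤ 2 * k + 1) p≡ p≤2k+1)))

antipodal-tournament : ∀ C k r p → C ≡ tri k + r → p ≡ suc k + suc k → k + 2 ≤ 2 * r →
                       Σ (Digraph p) λ H → Tournament H × Admissible C H
antipodal-tournament C k r p C≡ p≡ k+2≤2r =
  H , tournament refl , oriented , λ e → subst (load H e ≤_) (sym C≡) (load≤ r (subst (_≤ 2 * r) (+-suc k 1) k+2≤2r) e)
  where open ParityChoice k (suc k) p p≡ ≤-refl

case2-extremal : ∀ C k r p → C ≡ tri k + r → p ≡ suc k + suc k → 1 ≤ r → 2 * r < k + 2 →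
                 Extremal C p (CirculantSub k r) (k * p + 2 * r ∸ 1)
case2-extremal C k r p C≡ p≡ 1≤r 2r<k+2 =
  extremal H (circulant-sub r (λ r≡0 → contradiction r≡0 (≢-sym (<⇒≢ 1≤r))))
             (oriented , λ e → subst (load H e ≤_) (sym C≡) (load≤ r (≤-reflexive (m∸n+n≡m 1≤2r)) e))
             arcs≡v bound
  where
  1≤2r : 1 ≤ 2 * r
  1≤2r = ≤-trans 1≤r (m≤m+n r (r + 0))
  n≤k+1 : 2 * r ∸ 1 ≤ suc k
  n≤k+1 = ≤-trans (m∸n≤m (2 * r) 1) (s≤s⁻¹ (subst (2 * r <_) (+-comm k 2) 2r<k+2))
  open ParityChoice k (2 * r ∸ 1) p p≡ n≤k+1
  arcs≡v : arcs H ≡ k * p + 2 * r ∸ 1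
  arcs≡v = trans arcs≡ (trans (cong (_+ (2 * r ∸ 1)) (*-comm p k)) (sym (+-∸-assoc (k * p) 1≤2r)))
  bound : ∀ H′ → Admissible C H′ → arcs H′ ≤ k * p + 2 * r ∸ 1
  bound H′ admissible = subst (arcs H′ ≤_) (pred[m∸n]≡m∸[1+n] (k * p + 2 * r) 0)
    (<⇒≤pred (≰⇒> (Case2UpperBound.impossible C k r H′ 1≤r p≡ C≡ admissible)))

case3-extremal : ∀ C k r p → r ≤ k → C ≡ tri k + r → suc k + suc k ≤ p → (p ≡ suc k + suc k → r ≡ 0) →
                 Extremal C p (CirculantSub k r) (k * p + (r * p) / suc k)
case3-extremal C k r p r≤k C≡ 2m≤p antipodal-empty =
  extremal H (circulant-sub r none-chosen)
             (oriented antipodal-empty , λ e → subst (load H e ≤_) (sym C≡) (load≤ e))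
             arcs≡ (λ H′ → arcs≤ C k r H′ C≡ (<-trans (n<1+n k) m<p))
  where open SturmianChoice k r p r≤k 2m≤p

proposition2 : ∀ (C k r p : ℕ) → 1 ≤ k → r ≤ k → C ≡ (k * (k + 1)) / 2 + r → 2 ≤ p →
    (Case1 k r p →
       GammaIs C p ((p * (p ∸ 1)) / 2)
       × Σ (Digraph p) (λ H → Tournament H × Admissible C H × arcs H ≡ (p * (p ∸ 1)) / 2))
    × (Case2 k r p →
       GammaIs C p (k * p + 2 * r ∸ 1)
       × Σ (Digraph p) (λ H → CirculantSub k r H × Admissible C H × arcs H ≡ k * p + 2 * r ∸ 1))
    × (¬ Case1 k r p → ¬ Case2 k r p →
       GammaIs C p (k * p + (r * p) / suc k)
       × Σ (Digraph p) (λ H → CirculantSub k r H × Admissible C H × arcs H ≡ k * p + (r * p) / suc k))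
proposition2 C k r p _ r≤k C≡ 2≤p = case1 , case2 , case3
  where
  C≡tri+r : C ≡ tri k + r
  C≡tri+r = trans C≡ (cong (_+ r) (tri≡k[k+1]/2 k))
  2k+2≡2m : 2 * k + 2 ≡ suc k + suc k
  2k+2≡2m = twice-suc k
    where
    twice-suc : ∀ k → 2 * k + 2 ≡ suc k + suc k
    twice-suc = solve-∀
  case1 : Case1 k r p → Extremal C p Tournament ((p * (p ∸ 1)) / 2)
  case1 (inj₁ p≤2k+1)        = tournament-extremal
    (small-tournament C k p (subst (tri k ≤_) (sym C≡tri+r) (m≤m+n (tri k) r)) 2≤p p≤2k+1)
  case1 (inj₂ (p≡ , k+2≤2r)) = tournament-extremal (antipodal-tournament C k r p C≡tri+r (trans p≡ 2k+2≡2m) k+2≤2r)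
  case2 : Case2 k r p → Extremal C p (CirculantSub k r) (k * p + 2 * r ∸ 1)
  case2 (p≡ , 1≤r , 2r<k+2) = case2-extremal C k r p C≡tri+r (trans p≡ 2k+2≡2m) 1≤r 2r<k+2
  case3 : ¬ Case1 k r p → ¬ Case2 k r p → Extremal C p (CirculantSub k r) (k * p + (r * p) / suc k)
  case3 ¬case1 ¬case2 = case3-extremal C k r p r≤k C≡tri+r 2m≤p antipodal-empty
    where
    2m≤p : suc k + suc k ≤ p
    2m≤p with p ≤? 2 * k + 1
    ... | yes p≤2k+1 = contradiction (inj₁ p≤2k+1) ¬case1
    ... | no  p≰2k+1 = subst (_≤ p) (trans (+-comm 1 (2 * k + 1)) (trans (+-assoc (2 * k) 1 1) 2k+2≡2m)) (≰⇒> p≰2k+1)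
    antipodal-empty : p ≡ suc k + suc k → r ≡ 0
    antipodal-empty p≡2m with r ≟ 0 | k + 2 ≤? 2 * r
    ... | yes r≡0 | _         = r≡0
    ... | no  r≢0 | yes large = contradiction (inj₂ (trans p≡2m (sym 2k+2≡2m) , large)) ¬case1
    ... | no  r≢0 | no  small = contradiction (trans p≡2m (sym 2k+2≡2m) , n≢0⇒n>0 r≢0 , ≰⇒> small) ¬case2
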